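{- There are partial recursive functions $F$ and $G$ such that for each nonempty $B\subseteq\mathbb N$, $\theta:B\to\mathcal P^*\mathcal P(\mathbb N)$, $p\subseteq\mathbb N$, sight $S$ and numbers $z,w$: (i) if $S$ is $(z,\theta,p)$-dedicated then $F(z)$ is defined and $S$ is $(F(z),\theta,p)$-supporting; (ii) if $S$ is $(w,\theta,p)$-supporting then $G(w)$ is defined and $S$ is $(G(w),\theta,p)$-dedicated.
   Context: Notation: $ex$ is the (possibly undefined) result of applying the $e$-th partial recursive function to $x$; $\langle\cdot,\ldots,\cdot\rangle$ is a standard recursive coding of finite sequences, $\ast$ concatenation of coded sequences. $A\wedge C=\{\langle a,c\rangle\mid a\in A,c\in C\}$. A sight is, inductively, either NIL, or a pair $(A,\sigma)$ with $A\subseteq\mathbb N$ and $\sigma$ a function on $A$ whose values are sights. A sight $S$ is $(z,\theta,p)$-dedicated if either $S=\mathrm{NIL}$ and $z\in\{0\}\wedge p$, or $S=(A,\sigma)$, $z=\langle1,\langle n,e\rangle\rangle$ with $n\in B$, $A\in\theta(n)$, and for all $a\in A$, $ea$ is defined and $\sigma(a)$ is $(ea,\theta,p)$-dedicated. To a sight $S$ is associated a well-founded tree $\mathrm{Tr}(S)$ of coded sequences with a set of good leaves: if $S=\mathrm{NIL}$, $\mathrm{Tr}(S)=\{\langle\rangle\}$ and $\langle\rangle$ is a good leaf; if $S=(\emptyset,\emptyset)$, $\mathrm{Tr}(S)=\{\langle\rangle\}$ with no good leaf; if $S=(A,\sigma)$ with $A\ne\emptyset$, $\mathrm{Tr}(S)=\{\langle\rangle\}\cup\{\langle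 a\rangle\ast t\mid a\in A,t\in\mathrm{Tr}(\sigma(a))\}$ and $\langle a\rangle\ast t$ is a good leaf iff $t$ is a good leaf of $\mathrm{Tr}(\sigma(a))$. For $s\in\mathrm{Tr}(S)$, $\mathrm{Out}_S(s)=\{a\mid s\ast\langle a\rangle\in\mathrm{Tr}(S)\}$. A sight $S$ is $(w,\theta,p)$-supporting if for every good leaf $s$ of $S$, $ws\in\{0\}\wedge p$, and for every $s\in\mathrm{Tr}(S)$ which is not a good leaf, $ws=\langle1,n\rangle$ with $n\in B$ and $\mathrm{Out}_S(s)\in\theta(n)$. -}

module Defs where

open import Data.Nat using (ℕ; zero; suc; _+_; _*_; _∸_; _^_; _≟_)
open import Data.List using (List; []; _∷_; _++_; map)
open import Data.Maybe using (Maybe; just; nothing)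
open import Data.Product using (Σ; _×_; _,_)
open import Data.Unit using (⊤)
open import Data.Empty using (⊥)
open import Relation.Nullary using (¬_; yes; no)
open import Relation.Binary.PropositionalEquality using (_≡_)

π : ℕ → ℕ → ℕ
π a b = 2 ^ a * (2 * b + 1) ∸ 1

⌜_⌝ : List ℕ → ℕ
⌜ [] ⌝ = 0
⌜ x ∷ xs ⌝ = suc (π x ⌜ xs ⌝)

data Instr : Set where
  inc : (r j : ℕ) → Instr
  dec : (r j k : ℕ) → Instr      -- if R[r] = 0 then goto k else (R[r] := R[r]-1 ; goto j)

Program : Set
Program = List Instr

Regs : Set
Regs = ℕ → ℕ

_[_≔_] : Regs → ℕ → ℕ → Regs
(R [ r ≔ v ]) i with i ≟ r
... | yes _ = v
... | no  _ = R i

_‼_ : {A : Set} → List A → ℕ → Maybe A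
[] ‼ _ = nothing
(x ∷ xs) ‼ zero = just x
(x ∷ xs) ‼ suc n = xs ‼ n

data Run (P : Program) : ℕ → Regs → ℕ → Set where
  halt   : ∀ {pc R} → P ‼ pc ≡ nothing → Run P pc R (R 0)
  step-inc  : ∀ {pc R r j y} → P ‼ pc ≡ just (inc r j) →
              Run P j (R [ r ≔ suc (R r) ]) y → Run P pc R y
  step-dec0 : ∀ {pc R r j k y} → P ‼ pc ≡ just (dec r j k) → R r ≡ 0 →
              Run P k R y → Run P pc R y
  step-decS : ∀ {pc R r j k m y} → P ‼ pc ≡ just (dec r j k) → R r ≡ suc m →
              Run P j (R [ r ≔ m ]) y → Run P pc R y

⌜_⌝ᵢ : Instr → ℕ
⌜ inc r j ⌝ᵢ = 2 * π r j
⌜ dec r j k ⌝ᵢ = suc (2 * π r (π j k))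

⌜_⌝ₚ : Program → ℕ
⌜ P ⌝ₚ = ⌜ map ⌜_⌝ᵢ P ⌝

init : ℕ → Regs
init x zero = x
init x (suc _) = 0

_∙_↓_ : ℕ → ℕ → ℕ → Set
e ∙ x ↓ y = Σ Program λ P → (e ≡ ⌜ P ⌝ₚ) × Run P 0 (init x) y

_∙_∈_ : ℕ → ℕ → (ℕ → Set) → Set
e ∙ x ∈ X = Σ ℕ λ y → (e ∙ x ↓ y) × X y

Pred : Set₁
Pred = ℕ → Set

Zero∧ : Pred → Pred
Zero∧ p z = Σ ℕ λ c → p c × (z ≡ ⌜ 0 ∷ c ∷ [] ⌝)

-- A sight is NIL or (A , σ) with A ⊆ ℕ and σ a function on A with sight
-- values; σ is given as a total function whose values outside A are ignored.
data Sight : Set₁ where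
  NIL  : Sight
  node : (A : Pred) → (σ : ℕ → Sight) → Sight

InTr : Sight → List ℕ → Set
InTr NIL [] = ⊤
InTr NIL (_ ∷ _) = ⊥
InTr (node A σ) [] = ⊤
InTr (node A σ) (a ∷ t) = A a × InTr (σ a) t

GoodLeaf : Sight → List ℕ → Set
GoodLeaf NIL [] = ⊤
GoodLeaf NIL (_ ∷ _) = ⊥
GoodLeaf (node A σ) [] = ⊥
GoodLeaf (node A σ) (a ∷ t) = A a × GoodLeaf (σ a) t

Out : Sight → List ℕ → Pred
Out S s a = InTr S (s ++ a ∷ [])

-- Dedicated and supporting sights  (B ⊆ ℕ, θ : B → P(P(ℕ)), p ⊆ ℕ)
-- θ n X  means  X ∈ θ(n);  θ is given on all of ℕ but only used on B.

Dedicated : (B : Pred) → (θ : ℕ → Pred → Set) → (p : Pred) → ℕ → Sight → Set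
Dedicated B θ p z NIL = Zero∧ p z
Dedicated B θ p z (node A σ) =
  Σ ℕ λ n → Σ ℕ λ e →
    (z ≡ ⌜ 1 ∷ ⌜ n ∷ e ∷ [] ⌝ ∷ [] ⌝) × B n × θ n A ×
    (∀ a → A a → Σ ℕ λ y → (e ∙ a ↓ y) × Dedicated B θ p y (σ a))

Supporting : (B : Pred) → (θ : ℕ → Pred → Set) → (p : Pred) → ℕ → Sight → Set
Supporting B θ p w S =
  (∀ s → InTr S s → GoodLeaf S s → w ∙ ⌜ s ⌝ ∈ Zero∧ p) ×
  (∀ s → InTr S s → ¬ GoodLeaf S s →
     Σ ℕ λ n → (w ∙ ⌜ s ⌝ ↓ ⌜ 1 ∷ n ∷ [] ⌝) × B n × θ n (Out S s))

module Submission where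

-- F z is the index,
-- obtained by s-m-n, of the program that on input ⌜ s ⌝ follows s through the
-- dedication code z, replacing ⟨1,⟨n,e⟩⟩ by e a at each entry a, and finally
-- answers ⟨0,c⟩ or ⟨1,n⟩. G w returns w ⌜ [] ⌝ if it is ⟨0,c⟩, and otherwise
-- ⟨1,⟨n,e⟩⟩ where e maps a to G applied to the shifted index t ↦ w (⟨a⟩ ∗ t);
-- the self-reference is resolved by handing the program its own code, as in
-- the recursion theorem.

open import Defs
open import Data.Nat using (ℕ)
open import Data.Product using (Σ; _×_; _,_)
open import Function.Bundles using (_⇔_)

module Registers where

  open import Data.Nat using (suc; _≟_)
  open import Data.Empty using (⊥-elim)
  open import Relation.Nullary using (Dec; yes; no)
  open import Relation.Binary.PropositionalEquality

  upd-same : ∀ (R : Regs) r v → (R [ r ≔ v ]) r ≡ v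
  upd-same R r v with r ≟ r
  ... | yes _ = refl
  ... | no r≢r = ⊥-elim (r≢r refl)

  upd-other : ∀ (R : Regs) {r} v {i} → i ≢ r → (R [ r ≔ v ]) i ≡ R i
  upd-other R {r} v {i} i≢r with i ≟ r
  ... | yes i≡r = ⊥-elim (i≢r i≡r)
  ... | no _ = refl

  upd-cong : ∀ {R R' : Regs} r v → R ≗ R' → (R [ r ≔ v ]) ≗ (R' [ r ≔ v ])
  upd-cong r v R≗R' i with i ≟ r
  ... | yes _ = refl
  ... | no _ = R≗R' i

  upd-idem : ∀ (R : Regs) r u v → (R [ r ≔ u ] [ r ≔ v ]) ≗ (R [ r ≔ v ])
  upd-idem R r u v i with i ≟ r
  ... | yes _ = refl
  ... | no i≢r = upd-other R u i≢r

  upd-comm : ∀ (R : Regs) {r s} u v → r ≢ s → (R [ r ≔ u ] [ s ≔ v ]) ≗ (R [ s ≔ v ] [ r ≔ u ])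
  upd-comm R {r} {s} u v r≢s i = by-cases (i ≟ s) (i ≟ r)
    where
    by-cases : Dec (i ≡ s) → Dec (i ≡ r) → (R [ r ≔ u ] [ s ≔ v ]) i ≡ (R [ s ≔ v ] [ r ≔ u ]) i
    by-cases (yes refl) (yes refl) = ⊥-elim (r≢s refl)
    by-cases (yes refl) (no i≢r) = trans (upd-same _ i v) (sym (trans (upd-other _ u i≢r) (upd-same R i v)))
    by-cases (no i≢s) (yes refl) = trans (upd-other _ v i≢s) (trans (upd-same R i u) (sym (upd-same _ i u)))
    by-cases (no i≢s) (no i≢r) =
      trans (upd-other _ v i≢s) (trans (upd-other R u i≢r) (sym (trans (upd-other _ u i≢r) (upd-other R v i≢s))))

  upd-id : ∀ (R : Regs) r v → R r ≡ v → (R [ r ≔ v ]) ≗ R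
  upd-id R r v Rr≡v i with i ≟ r
  ... | yes refl = sym Rr≡v
  ... | no _ = refl

  ≗-refl : ∀ {R : Regs} → R ≗ R
  ≗-refl i = refl

  ≗-sym : ∀ {R R' : Regs} → R ≗ R' → R' ≗ R
  ≗-sym R≗R' i = sym (R≗R' i)

  Run-resp-≗ : ∀ {P pc R R' y} → R ≗ R' → Run P pc R y → Run P pc R' y
  Run-resp-≗ {R' = R'} R≗R' (halt h) = subst (Run _ _ R') (sym (R≗R' 0)) (halt h)
  Run-resp-≗ {R' = R'} R≗R' (step-inc {r = r} h run) =
    step-inc h (Run-resp-≗ (λ i → trans (upd-cong r _ R≗R' i) (cong (λ v → (R' [ r ≔ v ]) i) (cong suc (R≗R' r)))) run)
  Run-resp-≗ R≗R' (step-dec0 {r = r} h z run) = step-dec0 h (trans (sym (R≗R' r)) z) (Run-resp-≗ R≗R' run)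
  Run-resp-≗ R≗R' (step-decS {r = r} h z run) = step-decS h (trans (sym (R≗R' r)) z) (Run-resp-≗ (upd-cong r _ R≗R') run)

module Structured where

  open Registers
  open import Data.Nat
  open import Data.Nat.Properties
  open import Data.List using (List; []; _∷_; _++_; length)
  open import Data.List.Properties using (length-++)
  open import Data.Maybe using (just; nothing)
  open import Relation.Binary.PropositionalEquality
  open import Data.Nat.Tactic.RingSolver using (solve-∀)

  infixr 4 _︔_
  data Stmt : Set where
    SKIP : Stmt
    INC : ℕ → Stmt
    _︔_ : Stmt → Stmt → Stmt
    IFZ : ℕ → Stmt → Stmt → Stmt
    LOOP : ℕ → Stmt → Stmt

  -- Big-step semantics; conv identifies pointwise equal register files, which
  -- are functions and so cannot be identified by _≡_ here.
  data Exec : Stmt → Regs → Regs → Set where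
    conv : ∀ {s R R₁ R₂ R'} → R ≗ R₁ → Exec s R₁ R₂ → R₂ ≗ R' → Exec s R R'
    inc : ∀ {r R} → Exec (INC r) R (R [ r ≔ suc (R r) ])
    skip : ∀ {R} → Exec SKIP R R
    seq : ∀ {s t R R₁ R₂} → Exec s R R₁ → Exec t R₁ R₂ → Exec (s ︔ t) R R₂
    ifz0 : ∀ {r s t R R'} → R r ≡ 0 → Exec s R R' → Exec (IFZ r s t) R R'
    ifzS : ∀ {r s t R R' m} → R r ≡ suc m → Exec t (R [ r ≔ m ]) R' → Exec (IFZ r s t) R R'
    loop0 : ∀ {r b R} → R r ≡ 0 → Exec (LOOP r b) R R
    loopS : ∀ {r b R R₁ R' m} → R r ≡ suc m → Exec b (R [ r ≔ m ]) R₁ → Exec (LOOP r b) R₁ R' → Exec (LOOP r b) R R'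

  Exec-resp-≗ : ∀ {s R R₁ R'} → Exec s R R₁ → R₁ ≗ R' → Exec s R R'
  Exec-resp-≗ e q = conv ≗-refl e q

  size : Stmt → ℕ
  size SKIP = 0
  size (INC r) = 1
  size (s ︔ t) = size s + size t
  size (IFZ r s t) = 3 + size s + size t
  size (LOOP r b) = 3 + size b

  -- Unconditional jump from p to E: register 0 is incremented, then
  -- decremented by an instruction both of whose branches lead to E.
  jump : ℕ → ℕ → List Instr
  jump p E = inc 0 (suc p) ∷ dec 0 E E ∷ []

  compile : Stmt → ℕ → List Instr
  compile SKIP o = []
  compile (INC r) o = inc r (suc o) ∷ []
  compile (s ︔ t) o = compile s o ++ compile t (o + size s)
  compile (IFZ r s t) o = dec r (suc o + size s + 2) (suc o) ∷
    (compile s (suc o) ++ (jump (suc o + size s) (o + (3 + size s + size t)) ++ compile t (suc o + size s + 2)))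
  compile (LOOP r b) o = dec r (suc o) (o + (3 + size b)) ∷ (compile b (suc o) ++ jump (suc o + size b) o)

  compile-length : ∀ s o → length (compile s o) ≡ size s
  compile-length SKIP o = refl
  compile-length (INC r) o = refl
  compile-length (s ︔ t) o = trans (length-++ (compile s o)) (cong₂ _+_ (compile-length s o) (compile-length t _))
  compile-length (IFZ r s t) o = cong suc (trans (length-++ (compile s (suc o)))
    (trans (cong₂ _+_ (compile-length s _) (cong (2 +_) (compile-length t _)))
    (trans (+-suc (size s) (suc (size t))) (cong suc (+-suc (size s) (size t))))))
  compile-length (LOOP r b) o = cong suc (trans (length-++ (compile b (suc o)))
    (trans (cong (_+ 2) (compile-length b _)) (+-comm (size b) 2)))

  record Placed (P : Program) (o : ℕ) (xs : List Instr) : Set where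
    constructor mkPlaced
    field placed : ∀ i {ins} → xs ‼ i ≡ just ins → P ‼ (o + i) ≡ just ins
  open Placed

  ‼-at : ∀ {P : Program} {k k' ins} → k ≡ k' → P ‼ k ≡ just ins → P ‼ k' ≡ just ins
  ‼-at refl h = h

  Placed-head : ∀ {P o x xs} → Placed P o (x ∷ xs) → P ‼ o ≡ just x
  Placed-head {P} {o = o} a = ‼-at {P} (+-identityʳ o) (placed a 0 refl)

  Placed-tail : ∀ {P o x xs} → Placed P o (x ∷ xs) → Placed P (suc o) xs
  Placed-tail {P} {o = o} a = mkPlaced λ i h → ‼-at {P} (+-suc o i) (placed a (suc i) h)

  ‼-++ˡ : ∀ {A : Set} (xs ys : List A) i {x} → xs ‼ i ≡ just x → (xs ++ ys) ‼ i ≡ just x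
  ‼-++ˡ [] ys i ()
  ‼-++ˡ (x ∷ xs) ys zero h = h
  ‼-++ˡ (x ∷ xs) ys (suc i) h = ‼-++ˡ xs ys i h

  ‼-++ʳ : ∀ {A : Set} (xs ys : List A) i → (xs ++ ys) ‼ (length xs + i) ≡ ys ‼ i
  ‼-++ʳ [] ys i = refl
  ‼-++ʳ (x ∷ xs) ys i = ‼-++ʳ xs ys i

  Placed-++ˡ : ∀ {P o} xs ys → Placed P o (xs ++ ys) → Placed P o xs
  Placed-++ˡ xs ys a = mkPlaced λ i h → placed a i (‼-++ˡ xs ys i h)

  Placed-++ʳ : ∀ {P o p} xs ys → o + length xs ≡ p → Placed P o (xs ++ ys) → Placed P p ys
  Placed-++ʳ {P} {o} xs ys refl a = mkPlaced λ i h →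
    ‼-at {P} (sym (+-assoc o (length xs) i)) (placed a (length xs + i) (trans (‼-++ʳ xs ys i) h))

  Run-at : ∀ {P R y pc pc'} → pc ≡ pc' → Run P pc R y → Run P pc' R y
  Run-at refl r = r

  jump-correct : ∀ {P p E R y} → Placed P p (jump p E) → Run P E R y → Run P p R y
  jump-correct {R = R} a r = step-inc (Placed-head a)
    (step-decS (Placed-head (Placed-tail a)) (upd-same R 0 _)
      (Run-resp-≗ (λ i → sym (trans (upd-idem R 0 _ _ i) (upd-id R 0 _ refl i))) r))

  compile-correct : ∀ {s R R' P o y} → Exec s R R' → Placed P o (compile s o) → Run P (o + size s) R' y → Run P o R y
  compile-correct (conv q e q') a r = Run-resp-≗ (≗-sym q) (compile-correct e a (Run-resp-≗ (≗-sym q') r))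
  compile-correct {o = o} inc a r = step-inc (Placed-head a) (Run-at (+-comm o 1) r)
  compile-correct {o = o} skip a r = Run-at (+-identityʳ o) r
  compile-correct {s = s ︔ t} {o = o} (seq e1 e2) a r =
    compile-correct e1 (Placed-++ˡ (compile s o) _ a)
     (compile-correct e2 (Placed-++ʳ (compile s o) _ (cong (o +_) (compile-length s o)) a)
       (Run-at (sym (+-assoc o (size s) (size t))) r))
  compile-correct {s = IFZ c s t} {o = o} (ifz0 z e) a r =
    step-dec0 (Placed-head a) z
     (compile-correct e (Placed-++ˡ (compile s (suc o)) _ (Placed-tail a))
       (jump-correct (Placed-++ˡ (jump _ _) _ (Placed-++ʳ (compile s (suc o)) _ (cong (suc o +_) (compile-length s _)) (Placed-tail a))) r))
  compile-correct {s = IFZ c s t} {o = o} (ifzS z e) a r =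
    step-decS (Placed-head a) z
      (compile-correct e (Placed-++ʳ (jump _ _) _ refl (Placed-++ʳ (compile s (suc o)) _ (cong (suc o +_) (compile-length s _)) (Placed-tail a)))
        (Run-at (lem o (size s) (size t)) r))
    where
    lem : ∀ o a b → o + (3 + a + b) ≡ suc o + a + 2 + b
    lem = solve-∀
  compile-correct {s = LOOP c b} {o = o} (loop0 z) a r = step-dec0 (Placed-head a) z r
  compile-correct {s = LOOP c b} {o = o} (loopS z e el) a r =
    step-decS (Placed-head a) z
      (compile-correct e (Placed-++ˡ (compile b (suc o)) _ (Placed-tail a))
        (jump-correct (Placed-++ʳ (compile b (suc o)) _ (cong (suc o +_) (compile-length b _)) (Placed-tail a))
          (compile-correct el a r)))

  ‼-length : ∀ {A : Set} (xs : List A) → xs ‼ length xs ≡ nothing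
  ‼-length [] = refl
  ‼-length (x ∷ xs) = ‼-length xs

  Placed-self : ∀ xs → Placed xs 0 xs
  Placed-self xs = mkPlaced λ i h → h

  run-compiled : ∀ {s R R'} → Exec s R R' → Run (compile s 0) 0 R (R' 0)
  run-compiled {s} e = compile-correct e (Placed-self _) (halt (subst (λ k → compile s 0 ‼ k ≡ nothing) (compile-length s 0) (‼-length (compile s 0))))

module Frames where

  open Registers
  open import Data.Nat
  open import Data.Nat.Properties
  open import Data.Bool using (Bool; true; false; T; _∧_; _∨_)
  open import Data.Bool.Properties using (T-∧)
  open import Data.List using (List; []; _∷_)
  open import Data.List.Relation.Unary.All using (All; []; _∷_)
  open import Data.Product using (proj₁; proj₂)
  open import Function.Bundles using (Equivalence)
  open import Data.Sum using (_⊎_; inj₁; inj₂)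
  open import Relation.Nullary using (yes; no)
  open import Relation.Binary.PropositionalEquality

  ZeroFrom : ℕ → Regs → Set
  ZeroFrom b R = ∀ i → b ≤ i → R i ≡ 0

  ZeroFrom-mono : ∀ {a b R} → a ≤ b → ZeroFrom a R → ZeroFrom b R
  ZeroFrom-mono a≤b z i b≤i = z i (≤-trans a≤b b≤i)

  <ᵇ-lit : ∀ {m n} → T (m <ᵇ n) → m < n
  <ᵇ-lit {m} {n} = <ᵇ⇒< m n

  ≗-by₂ : ∀ {A B : Regs} d s → A d ≡ B d → A s ≡ B s → (∀ i → i ≢ d → i ≢ s → A i ≡ B i) → A ≗ B
  ≗-by₂ d s ed es eo i with i ≟ d | i ≟ s
  ... | yes refl | _ = ed
  ... | no _ | yes refl = es
  ... | no i≢d | no i≢s = eo i i≢d i≢s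

  ≗-by₃ : ∀ {A B : Regs} d s t → A d ≡ B d → A s ≡ B s → A t ≡ B t →
    (∀ i → i ≢ d → i ≢ s → i ≢ t → A i ≡ B i) → A ≗ B
  ≗-by₃ d s t ed es et eo i with i ≟ d | i ≟ s | i ≟ t
  ... | yes refl | _ | _ = ed
  ... | no _ | yes refl | _ = es
  ... | no _ | no _ | yes refl = et
  ... | no i≢d | no i≢s | no i≢t = eo i i≢d i≢s i≢t

  -- Updated X A: A is X followed by a chain of updates, found by instance
  -- search. Two such files agree once they agree on the updated registers, and
  -- for concrete register numbers the Boolean side conditions below (⊆ᵇ, all<ᵇ,
  -- all≥ᵇ) are discharged by evaluation.
  record Updated (X A : Regs) : Set where
    field
      updated-keys : List ℕ
      not-updated : ∀ i → All (i ≢_) updated-keys → A i ≡ X i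
  open Updated public

  instance
    updated-none : ∀ {X} → Updated X X
    updated-none = record { updated-keys = [] ; not-updated = λ i _ → refl }

    updated-step : ∀ {X A k v} → {{c : Updated X A}} → Updated X (A [ k ≔ v ])
    updated-step {A = A} {k} {v} {{c}} = record
      { updated-keys = k ∷ updated-keys c
      ; not-updated = λ { i (i≢k ∷ rest) → trans (upd-other A v i≢k) (not-updated c i rest) } }

  private
    T∧ˡ : ∀ {x y} → T (x ∧ y) → T x
    T∧ˡ t = proj₁ (Equivalence.to T-∧ t)

    T∧ʳ : ∀ {x y} → T (x ∧ y) → T y
    T∧ʳ t = proj₂ (Equivalence.to T-∧ t)

  ∈ᵇ : ℕ → List ℕ → Bool
  ∈ᵇ i [] = false
  ∈ᵇ i (k ∷ ks) = (i ≡ᵇ k) ∨ ∈ᵇ i ks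

  ⊆ᵇ : List ℕ → List ℕ → Bool
  ⊆ᵇ [] ks = true
  ⊆ᵇ (x ∷ xs) ks = ∈ᵇ x ks ∧ ⊆ᵇ xs ks

  all<ᵇ : ℕ → List ℕ → Bool
  all<ᵇ b [] = true
  all<ᵇ b (k ∷ ks) = (k <ᵇ b) ∧ all<ᵇ b ks

  all≥ᵇ : ℕ → List ℕ → Bool
  all≥ᵇ b [] = true
  all≥ᵇ b (k ∷ ks) = (b ≤ᵇ k) ∧ all≥ᵇ b ks

  ∈ᵇ⇒≢ : ∀ i x ks → T (∈ᵇ x ks) → All (i ≢_) ks → i ≢ x
  ∈ᵇ⇒≢ i x (k ∷ ks) x∈ks (i≢k ∷ rest) i≡x with x ≡ᵇ k in eq
  ... | true = i≢k (trans i≡x (≡ᵇ⇒≡ x k (subst T (sym eq) _)))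
  ... | false = ∈ᵇ⇒≢ i x ks x∈ks rest i≡x

  ⊆ᵇ⇒All≢ : ∀ i xs ks → T (⊆ᵇ xs ks) → All (i ≢_) ks → All (i ≢_) xs
  ⊆ᵇ⇒All≢ i [] ks _ _ = []
  ⊆ᵇ⇒All≢ i (x ∷ xs) ks t all = ∈ᵇ⇒≢ i x ks (T∧ˡ t) all ∷ ⊆ᵇ⇒All≢ i xs ks (T∧ʳ t) all

  all<ᵇ⇒All≢ : ∀ b i ks → T (all<ᵇ b ks) → b ≤ i → All (i ≢_) ks
  all<ᵇ⇒All≢ b i [] _ _ = []
  all<ᵇ⇒All≢ b i (k ∷ ks) t b≤i =
    (λ i≡k → <⇒≱ (<ᵇ⇒< k b (T∧ˡ t)) (subst (b ≤_) i≡k b≤i)) ∷ all<ᵇ⇒All≢ b i ks (T∧ʳ t) b≤i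

  all≥ᵇ⇒All≢ : ∀ b i ks → T (all≥ᵇ b ks) → i < b → All (i ≢_) ks
  all≥ᵇ⇒All≢ b i [] _ _ = []
  all≥ᵇ⇒All≢ b i (k ∷ ks) t i<b =
    (λ i≡k → <⇒≱ i<b (subst (b ≤_) (sym i≡k) (≤ᵇ⇒≤ b k (T∧ˡ t)))) ∷ all≥ᵇ⇒All≢ b i ks (T∧ʳ t) i<b

  All-or-≢ : ∀ {P : ℕ → Set} i ks → All P ks → All (i ≢_) ks ⊎ P i
  All-or-≢ i [] [] = inj₁ []
  All-or-≢ i (k ∷ ks) (p ∷ ps) with i ≟ k
  ... | yes refl = inj₂ p
  ... | no i≢k with All-or-≢ i ks ps
  ... | inj₁ rest = inj₁ (i≢k ∷ rest)
  ... | inj₂ q = inj₂ q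

  Updated-≗ : ∀ X {A B} {{ca : Updated X A}} {{cb : Updated X B}} (ks : List ℕ) →
    {T (⊆ᵇ (updated-keys ca) ks ∧ ⊆ᵇ (updated-keys cb) ks)} → All (λ k → A k ≡ B k) ks → A ≗ B
  Updated-≗ X {{ca}} {{cb}} ks {t} agree i with All-or-≢ i ks agree
  ... | inj₂ q = q
  ... | inj₁ i∉ks = trans (not-updated ca i (⊆ᵇ⇒All≢ i (updated-keys ca) ks (T∧ˡ t) i∉ks))
                          (sym (not-updated cb i (⊆ᵇ⇒All≢ i (updated-keys cb) ks (T∧ʳ t) i∉ks)))

  Updated-below : ∀ {X A} {{c : Updated X A}} b → {T (all≥ᵇ b (updated-keys c))} → ∀ i → i < b → A i ≡ X i
  Updated-below {{c}} b {t} i i<b = not-updated c i (all≥ᵇ⇒All≢ b i (updated-keys c) t i<b)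

  ZeroFrom-Updated : ∀ b {X A} {{c : Updated X A}} → {T (all<ᵇ b (updated-keys c))} → ZeroFrom b X → ZeroFrom b A
  ZeroFrom-Updated b {{c}} {t} z i b≤i = trans (not-updated c i (all<ᵇ⇒All≢ b i (updated-keys c) t b≤i)) (z i b≤i)

module Pairing where

  open import Data.Nat
  open import Data.Nat.Properties
  open import Relation.Binary.PropositionalEquality

  -- ⌜ x ∷ xs ⌝ ≡ cons x ⌜ xs ⌝; unlike π, this form needs no truncated subtraction.
  cons : ℕ → ℕ → ℕ
  cons a b = 2 ^ a * (2 * b + 1)

  cons-positive : ∀ a b → 1 ≤ cons a b
  cons-positive a b = *-mono-≤ {1} {2 ^ a} {1} {2 * b + 1} (m^n>0 2 a) (subst (1 ≤_) (+-comm 1 (2 * b)) (s≤s z≤n))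

  suc-π : ∀ a b → suc (π a b) ≡ cons a b
  suc-π a b = trans (+-comm 1 (cons a b ∸ 1)) (m∸n+n≡m (cons-positive a b))

  cons-suc : ∀ a b → cons (suc a) b ≡ 2 * cons a b
  cons-suc a b = *-assoc 2 (2 ^ a) (2 * b + 1)

  cons-zero : ∀ b → cons 0 b ≡ suc (2 * b)
  cons-zero b = trans (+-identityʳ (2 * b + 1)) (+-comm (2 * b) 1)

  ⌊2m/2⌋≡m : ∀ m → ⌊ 2 * m /2⌋ ≡ m
  ⌊2m/2⌋≡m zero = refl
  ⌊2m/2⌋≡m (suc m) rewrite +-suc m (m + 0) = cong suc (⌊2m/2⌋≡m m)

  2m%2≡0 : ∀ m → 2 * m % 2 ≡ 0
  2m%2≡0 zero = refl
  2m%2≡0 (suc m) rewrite +-suc m (m + 0) = 2m%2≡0 m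

  ⌊1+2m/2⌋≡m : ∀ m → ⌊ suc (2 * m) /2⌋ ≡ m
  ⌊1+2m/2⌋≡m zero = refl
  ⌊1+2m/2⌋≡m (suc m) rewrite +-suc m (m + 0) = cong suc (⌊1+2m/2⌋≡m m)

  [1+2m]%2≡1 : ∀ m → suc (2 * m) % 2 ≡ 1
  [1+2m]%2≡1 zero = refl
  [1+2m]%2≡1 (suc m) rewrite +-suc m (m + 0) = [1+2m]%2≡1 m

module Macros where

  open Registers
  open Structured
  open Frames
  open import Data.Nat
  open import Data.Nat.Properties
  open import Relation.Binary.PropositionalEquality

  ZERO : ℕ → Stmt
  ZERO d = LOOP d SKIP

  MOVE : ℕ → ℕ → Stmt
  MOVE d s = LOOP s (INC d)

  COPY : ℕ → ℕ → ℕ → Stmt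
  COPY d s t = ZERO d ︔ (LOOP s (INC d ︔ INC t) ︔ MOVE s t)

  PRED : ℕ → Stmt
  PRED d = IFZ d SKIP SKIP

  zero-correct : ∀ d R → Exec (ZERO d) R (R [ d ≔ 0 ])
  zero-correct d R = by-count (R d) R refl
    where
    by-count : ∀ k R → R d ≡ k → Exec (ZERO d) R (R [ d ≔ 0 ])
    by-count zero R z = Exec-resp-≗ (loop0 z) (≗-sym (upd-id R d 0 z))
    by-count (suc m) R z = loopS z skip (Exec-resp-≗ (by-count m (R [ d ≔ m ]) (upd-same R d m)) (upd-idem R d m 0))

  pred-correct : ∀ d R → Exec (PRED d) R (R [ d ≔ pred (R d) ])
  pred-correct d R with R d in eq
  ... | zero = ifz0 eq (Exec-resp-≗ skip (≗-sym (upd-id R d 0 eq)))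
  ... | suc m = ifzS eq skip

  move-correct : ∀ d s R → d ≢ s → Exec (MOVE d s) R (R [ s ≔ 0 ] [ d ≔ R d + R s ])
  move-correct d s R d≢s = by-count (R s) R refl
    where
    s≢d : s ≢ d
    s≢d = ≢-sym d≢s
    by-count : ∀ k R → R s ≡ k → Exec (MOVE d s) R (R [ s ≔ 0 ] [ d ≔ R d + R s ])
    by-count zero R z = Exec-resp-≗ (loop0 z) (≗-by₂ d s
      (sym (trans (upd-same _ d _) (trans (cong (R d +_) z) (+-identityʳ (R d)))))
      (sym (trans (upd-other _ _ s≢d) (trans (upd-same R s 0) (sym z))))
      (λ i n1 n2 → sym (trans (upd-other _ _ n1) (upd-other R _ n2))))
    by-count (suc m) R z = loopS z inc (Exec-resp-≗ (by-count m R2 R2s) (≗-by₂ d s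
        (trans (upd-same _ d _) (trans (cong₂ _+_ R2d R2s) (trans (sym (+-suc (R d) m)) (sym (trans (upd-same _ d _) (cong (R d +_) z))))))
        (trans (upd-other _ _ s≢d) (trans (upd-same R2 s 0) (sym (trans (upd-other _ _ s≢d) (upd-same R s 0)))))
        (λ i n1 n2 → trans (upd-other _ _ n1) (trans (upd-other R2 _ n2) (trans (upd-other _ _ n1) (trans (upd-other R _ n2)
          (sym (trans (upd-other _ _ n1) (upd-other R _ n2)))))))))
      where
      R1 R2 : Regs
      R1 = R [ s ≔ m ]
      R2 = R1 [ d ≔ suc (R1 d) ]
      R2s : R2 s ≡ m
      R2s = trans (upd-other R1 _ s≢d) (upd-same R s m)
      R2d : R2 d ≡ suc (R d)
      R2d = trans (upd-same R1 d _) (cong suc (upd-other R m d≢s))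

  split-correct : ∀ d s t R → d ≢ s → d ≢ t → s ≢ t →
    Exec (LOOP s (INC d ︔ INC t)) R (R [ s ≔ 0 ] [ d ≔ R d + R s ] [ t ≔ R t + R s ])
  split-correct d s t R d≢s d≢t s≢t = by-count (R s) R refl
    where
    s≢d : s ≢ d
    s≢d = ≢-sym d≢s
    t≢d : t ≢ d
    t≢d = ≢-sym d≢t
    t≢s : t ≢ s
    t≢s = ≢-sym s≢t
    by-count : ∀ k R → R s ≡ k → Exec (LOOP s (INC d ︔ INC t)) R (R [ s ≔ 0 ] [ d ≔ R d + R s ] [ t ≔ R t + R s ])
    by-count zero R z = Exec-resp-≗ (loop0 z) (≗-by₃ d s t
      (sym (trans (upd-other _ _ d≢t) (trans (upd-same _ d _) (trans (cong (R d +_) z) (+-identityʳ (R d))))))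
      (sym (trans (upd-other _ _ s≢t) (trans (upd-other _ _ s≢d) (trans (upd-same R s 0) (sym z)))))
      (sym (trans (upd-same _ t _) (trans (cong (R t +_) z) (+-identityʳ (R t)))))
      (λ i n1 n2 n3 → sym (trans (upd-other _ _ n3) (trans (upd-other _ _ n1) (upd-other R _ n2)))))
    by-count (suc m) R z = loopS z (seq inc inc) (Exec-resp-≗ (by-count m R3 R3s) (≗-by₃ d s t
        (trans (upd-other _ _ d≢t) (trans (upd-same _ d _) (trans (cong₂ _+_ R3d R3s)
          (trans (sym (+-suc (R d) m)) (sym (trans (upd-other _ _ d≢t) (trans (upd-same _ d _) (cong (R d +_) z))))))))
        (trans (upd-other _ _ s≢t) (trans (upd-other _ _ s≢d) (trans (upd-same R3 s 0)
          (sym (trans (upd-other _ _ s≢t) (trans (upd-other _ _ s≢d) (upd-same R s 0)))))))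
        (trans (upd-same _ t _) (trans (cong₂ _+_ R3t R3s)
          (trans (sym (+-suc (R t) m)) (sym (trans (upd-same _ t _) (cong (R t +_) z))))))
        (λ i n1 n2 n3 → trans (upd-other _ _ n3) (trans (upd-other _ _ n1) (trans (upd-other R3 _ n2)
          (trans (upd-other _ _ n3) (trans (upd-other _ _ n1) (trans (upd-other R _ n2)
          (sym (trans (upd-other _ _ n3) (trans (upd-other _ _ n1) (upd-other R _ n2))))))))))))
      where
      R1 R2 R3 : Regs
      R1 = R [ s ≔ m ]
      R2 = R1 [ d ≔ suc (R1 d) ]
      R3 = R2 [ t ≔ suc (R2 t) ]
      R3s : R3 s ≡ m
      R3s = trans (upd-other R2 _ s≢t) (trans (upd-other R1 _ s≢d) (upd-same R s m))
      R3d : R3 d ≡ suc (R d)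
      R3d = trans (upd-other R2 _ d≢t) (trans (upd-same R1 d _) (cong suc (upd-other R m d≢s)))
      R3t : R3 t ≡ suc (R t)
      R3t = trans (upd-same R2 t _) (cong suc (trans (upd-other R1 _ t≢d) (upd-other R m t≢s)))

  copy-correct : ∀ d s t R → d ≢ s → d ≢ t → s ≢ t → R t ≡ 0 → Exec (COPY d s t) R (R [ d ≔ R s ])
  copy-correct d s t R d≢s d≢t s≢t zt =
    seq (zero-correct d R) (seq (split-correct d s t R1 d≢s d≢t s≢t) (Exec-resp-≗ (move-correct s t R2 s≢t) (≗-by₃ d s t
       (trans (upd-other _ _ d≢s) (trans (upd-other _ _ d≢t) (trans (upd-other _ _ d≢t) (trans (upd-same _ d _) (trans (cong (_+ R1 s) (upd-same R d 0))
         (trans (upd-other R 0 s≢d) (sym (upd-same R d _))))))))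
       (trans (upd-same _ s _) (trans (cong₂ _+_ R2s R2t) (trans (trans (cong (_+ R1 s) (trans (upd-other R 0 t≢d) zt)) (upd-other R 0 s≢d))
         (sym (upd-other R _ s≢d)))))
       (trans (upd-other _ _ t≢s) (trans (upd-same R2 t 0) (sym (trans (upd-other R _ t≢d) zt))))
       (λ i n1 n2 n3 → trans (upd-other _ _ n2) (trans (upd-other _ _ n3) (trans (upd-other _ _ n3) (trans (upd-other _ _ n1)
         (trans (upd-other _ _ n2) (trans (upd-other R _ n1) (sym (upd-other R _ n1)))))))))))
    where
    s≢d : s ≢ d
    s≢d = ≢-sym d≢s
    t≢d : t ≢ d
    t≢d = ≢-sym d≢t
    t≢s : t ≢ s
    t≢s = ≢-sym s≢t
    R1 R2 : Regs
    R1 = R [ d ≔ 0 ]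
    R2 = R1 [ s ≔ 0 ] [ d ≔ R1 d + R1 s ] [ t ≔ R1 t + R1 s ]
    R2s : R2 s ≡ 0
    R2s = trans (upd-other _ _ s≢t) (trans (upd-other _ _ s≢d) (upd-same R1 s 0))
    R2t : R2 t ≡ R1 t + R1 s
    R2t = upd-same _ t _

module Calls where

  open Registers
  open Structured
  open Frames
  open Macros
  open import Data.Nat
  open import Data.Nat.Properties
  open import Data.Bool using (T)
  open import Relation.Binary.PropositionalEquality

  TRANSFER : ℕ → ℕ → Stmt
  TRANSFER d s = ZERO d ︔ MOVE d s

  transfer-correct : ∀ d s R → d ≢ s → Exec (TRANSFER d s) R (R [ s ≔ 0 ] [ d ≔ R s ])
  transfer-correct d s R d≢s = seq (zero-correct d R) (Exec-resp-≗ (move-correct d s (R [ d ≔ 0 ]) d≢s) (≗-by₂ d s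
    (trans (upd-same _ d _) (trans (cong₂ _+_ (upd-same R d 0) (upd-other R 0 s≢d)) (sym (upd-same _ d _))))
    (trans (upd-other _ _ s≢d) (trans (upd-same _ s 0) (sym (trans (upd-other _ _ s≢d) (upd-same R s 0)))))
    (λ i n1 n2 → trans (upd-other _ _ n1) (trans (upd-other _ _ n2) (trans (upd-other R _ n1) (sym (trans (upd-other _ _ n1) (upd-other R _ n2))))))))
    where
    s≢d : s ≢ d
    s≢d = ≢-sym d≢s

  low≢high : ∀ {x} t → x < 100 → {T (99 <ᵇ t)} → x ≢ t
  low≢high t lt {p} refl = <⇒≱ lt (<ᵇ-lit p)

  high≢low : ∀ {x} t → x < 100 → {T (99 <ᵇ t)} → t ≢ x
  high≢low t lt {p} e = low≢high t lt {p} (sym e)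

  -- Calling convention for bodies: registers from 100 on are scratch and start
  -- at 0, the arguments are placed in 100 and 101, and the results are left in
  -- 102 and 103 with every other register restored.
  Computes₁ : Stmt → (ℕ → ℕ → ℕ) → Set
  Computes₁ c f = ∀ R a b → ZeroFrom 100 R → Exec c (R [ 100 ≔ a ] [ 101 ≔ b ]) (R [ 102 ≔ f a b ])

  Computes₂ : Stmt → (ℕ → ℕ → ℕ → ℕ → Set) → Set
  Computes₂ c Rel = ∀ R a b o1 o2 → ZeroFrom 100 R → Rel a b o1 o2 → Exec c (R [ 100 ≔ a ] [ 101 ≔ b ]) (R [ 102 ≔ o1 ] [ 103 ≔ o2 ])

  LOAD-ARGS : ℕ → ℕ → Stmt
  LOAD-ARGS y z = COPY 100 y 109 ︔ COPY 101 z 109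

  load-args-correct : ∀ {R y z} → y < 100 → z < 100 → ZeroFrom 100 R → Exec (LOAD-ARGS y z) R (R [ 100 ≔ R y ] [ 101 ≔ R z ])
  load-args-correct {R} {y} {z} ly lz zr = seq (copy-correct 100 y 109 R (high≢low 100 ly) (λ ()) (low≢high 109 ly) (zr 109 (<ᵇ-lit _)))
    (Exec-resp-≗ (copy-correct 101 z 109 (R [ 100 ≔ R y ]) (high≢low 101 lz) (λ ()) (low≢high 109 lz) (zr 109 (<ᵇ-lit _)))
      λ i → cong (λ v → ((R [ 100 ≔ R y ]) [ 101 ≔ v ]) i) (upd-other R _ (low≢high 100 lz)))

  CALL₁ : Stmt → ℕ → ℕ → ℕ → Stmt
  CALL₁ c d y z = LOAD-ARGS y z ︔ c ︔ TRANSFER d 102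

  call₁-correct : ∀ {c f} → Computes₁ c f → ∀ {R d y z} → d < 100 → y < 100 → z < 100 → ZeroFrom 100 R →
    Exec (CALL₁ c d y z) R (R [ d ≔ f (R y) (R z) ])
  call₁-correct {c} {f} C {R} {d} {y} {z} ld ly lz zr =
    seq (load-args-correct ly lz zr) (seq (C R (R y) (R z) zr) (Exec-resp-≗ (transfer-correct d 102 R3 (low≢high 102 ld)) (≗-by₂ d 102
      (trans (upd-same _ d _) (sym (upd-same R d _)))
      (trans (upd-other _ _ (high≢low 102 ld)) (trans (upd-same R3 102 0) (sym (trans (upd-other R _ (high≢low 102 ld)) (zr 102 (<ᵇ-lit _))))))
      (λ i n1 n2 → trans (upd-other _ _ n1) (trans (upd-other _ _ n2) (trans (upd-other R _ n2) (sym (upd-other R _ n1))))))))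
    where
    R3 : Regs
    R3 = R [ 102 ≔ f (R y) (R z) ]

  CALL₂ : Stmt → ℕ → ℕ → ℕ → ℕ → Stmt
  CALL₂ c d1 d2 y z = LOAD-ARGS y z ︔ c ︔ TRANSFER d1 102 ︔ TRANSFER d2 103

  call₂-correct : ∀ {c Rel} → Computes₂ c Rel → ∀ {R d1 d2 y z o1 o2} → d1 < 100 → d2 < 100 → d1 ≢ d2 → y < 100 → z < 100 → ZeroFrom 100 R →
    Rel (R y) (R z) o1 o2 → Exec (CALL₂ c d1 d2 y z) R (R [ d1 ≔ o1 ] [ d2 ≔ o2 ])
  call₂-correct {c} C {R} {d1} {d2} {y} {z} {o1} {o2} l1 l2 n12 ly lz zr rel =
    seq (load-args-correct ly lz zr) (seq (C R (R y) (R z) o1 o2 zr rel)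
      (seq (Exec-resp-≗ (transfer-correct d1 102 R3 (low≢high 102 l1)) q1)
        (Exec-resp-≗ (transfer-correct d2 103 R4 (low≢high 103 l2)) q2)))
    where
    R3 R4 : Regs
    R3 = R [ 102 ≔ o1 ] [ 103 ≔ o2 ]
    R4 = R [ 103 ≔ o2 ] [ d1 ≔ o1 ]
    q1 : (R3 [ 102 ≔ 0 ] [ d1 ≔ R3 102 ]) ≗ R4
    q1 = ≗-by₂ d1 102
      (trans (upd-same _ d1 _) (sym (upd-same _ d1 _)))
      (trans (upd-other _ _ (high≢low 102 l1)) (trans (upd-same R3 102 0) (sym (trans (upd-other _ _ (high≢low 102 l1)) (zr 102 (<ᵇ-lit _))))))
      (λ i n1 n2 → trans (upd-other _ _ n1) (trans (upd-other _ _ n2) (trans (upd-comm R o1 o2 (λ ()) i) (trans (upd-other _ _ n2) (sym (upd-other _ _ n1))))))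
    q2 : (R4 [ 103 ≔ 0 ] [ d2 ≔ R4 103 ]) ≗ (R [ d1 ≔ o1 ] [ d2 ≔ o2 ])
    q2 = ≗-by₃ d2 103 d1
      (trans (upd-same _ d2 _) (trans (trans (upd-other _ _ (high≢low 103 l1)) (upd-same R 103 o2)) (sym (upd-same _ d2 _))))
      (trans (upd-other _ _ {103} (high≢low 103 l2)) (trans (upd-same R4 103 0) (sym (trans (upd-other _ _ {103} (high≢low 103 l2))
        (trans (upd-other _ _ {103} (high≢low 103 l1)) (zr 103 (<ᵇ-lit _)))))))
      (trans (upd-other _ _ n12)
        (trans (upd-other _ _ (low≢high 103 l1)) (trans (upd-same _ d1 _) (sym (trans (upd-other _ _ n12) (upd-same _ d1 _))))))
      (λ i n1 n2 n3 → trans (upd-other _ _ n1) (trans (upd-other _ _ n2) (trans (upd-other _ _ n3) (trans (upd-other _ _ n2)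
        (sym (trans (upd-other _ _ n1) (upd-other _ _ n3)))))))

module ArithmeticBodies where

  open Registers
  open Structured
  open Frames
  open Macros
  open Calls
  open Pairing
  open import Data.Nat
  open import Data.Nat.Properties
  open import Data.List using ([]; _∷_)
  open import Data.List.Relation.Unary.All using ([]; _∷_)
  open import Data.Product using (_×_; _,_)
  open import Data.Sum using (_⊎_; inj₁; inj₂)
  open import Data.Bool using (T)
  open import Relation.Binary.PropositionalEquality
  open import Data.Nat.Tactic.RingSolver using (solve-∀)

  zero-at : ∀ {R} → ZeroFrom 100 R → ∀ k → {T (99 <ᵇ k)} → R k ≡ 0
  zero-at zr k {p} = zr k (<ᵇ-lit p)

  ADD-BODY : Stmt
  ADD-BODY = MOVE 102 100 ︔ MOVE 102 101

  add-body-correct : Computes₁ ADD-BODY _+_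
  add-body-correct R a b zr = seq (move-correct 102 100 _ (λ ())) (Exec-resp-≗ (move-correct 102 101 _ (λ ()))
    (Updated-≗ R (100 ∷ 101 ∷ 102 ∷ []) (sym (zero-at zr 100) ∷ sym (zero-at zr 101) ∷ q ∷ [])))
    where
    q : R 102 + a + b ≡ a + b
    q = cong (λ v → v + a + b) (zero-at zr 102)

  add-twice-lemma : ∀ x m → 2 + x + 2 * m ≡ x + 2 * suc m
  add-twice-lemma = solve-∀

  add-twice-correct : ∀ d s R → d ≢ s → Exec (LOOP s (INC d ︔ INC d)) R (R [ s ≔ 0 ] [ d ≔ R d + 2 * R s ])
  add-twice-correct d s R d≢s = by-count (R s) R refl
    where
    s≢d : s ≢ d
    s≢d = ≢-sym d≢s
    by-count : ∀ k R → R s ≡ k → Exec (LOOP s (INC d ︔ INC d)) R (R [ s ≔ 0 ] [ d ≔ R d + 2 * R s ])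
    by-count zero R z = Exec-resp-≗ (loop0 z) (≗-by₂ d s
      (sym (trans (upd-same _ d _) (trans (cong (λ v → R d + 2 * v) z) (+-identityʳ (R d)))))
      (sym (trans (upd-other _ _ s≢d) (trans (upd-same R s 0) (sym z))))
      (λ i n1 n2 → sym (trans (upd-other _ _ n1) (upd-other R _ n2))))
    by-count (suc m) R z = loopS z (seq inc inc) (Exec-resp-≗ (by-count m R3 R3s) (≗-by₂ d s
        (trans (upd-same _ d _) (trans (cong₂ (λ u v → u + 2 * v) R3d R3s) (trans ar (sym (trans (upd-same _ d _) (cong (λ v → R d + 2 * v) z))))))
        (trans (upd-other _ _ s≢d) (trans (upd-same R3 s 0) (sym (trans (upd-other _ _ s≢d) (upd-same R s 0)))))
        (λ i n1 n2 → trans (upd-other _ _ n1) (trans (upd-other R3 _ n2) (trans (upd-other _ _ n1) (trans (upd-other _ _ n1) (trans (upd-other R _ n2)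
          (sym (trans (upd-other _ _ n1) (upd-other R _ n2))))))))))
      where
      R1 R2 R3 : Regs
      R1 = R [ s ≔ m ]
      R2 = R1 [ d ≔ suc (R1 d) ]
      R3 = R2 [ d ≔ suc (R2 d) ]
      R3s : R3 s ≡ m
      R3s = trans (upd-other R2 _ s≢d) (trans (upd-other R1 _ s≢d) (upd-same R s m))
      R3d : R3 d ≡ suc (suc (R d))
      R3d = trans (upd-same R2 d _) (cong suc (trans (upd-same R1 d _) (cong suc (upd-other R m d≢s))))
      ar : suc (suc (R d)) + 2 * m ≡ R d + 2 * suc m
      ar = add-twice-lemma (R d) m

  DOUBLE : Stmt
  DOUBLE = MOVE 104 102 ︔ LOOP 104 (INC 102 ︔ INC 102)

  double-correct : ∀ X → X 104 ≡ 0 → Exec DOUBLE X (X [ 102 ≔ 2 * X 102 ])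
  double-correct X z4 = seq (move-correct 104 102 X (λ ())) (Exec-resp-≗ (add-twice-correct 102 104 _ (λ ()))
    (Updated-≗ X (104 ∷ 102 ∷ []) (sym z4 ∷ q ∷ [])))
    where
    q : 0 + 2 * (X 104 + X 102) ≡ 2 * X 102
    q = cong (λ v → 2 * (v + X 102)) z4

  double-loop-correct : ∀ k X → X 100 ≡ k → X 104 ≡ 0 → Exec (LOOP 100 DOUBLE) X (X [ 100 ≔ 0 ] [ 102 ≔ 2 ^ k * X 102 ])
  double-loop-correct zero X z z4 = Exec-resp-≗ (loop0 z) (Updated-≗ X (100 ∷ 102 ∷ []) (z ∷ sym (*-identityˡ (X 102)) ∷ []))
  double-loop-correct (suc m) X z z4 = loopS z (double-correct (X [ 100 ≔ m ]) z4)
    (Exec-resp-≗ (double-loop-correct m _ refl z4) (Updated-≗ X (100 ∷ 102 ∷ []) (refl ∷ q ∷ [])))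
    where
    q : 2 ^ m * (2 * X 102) ≡ 2 * 2 ^ m * X 102
    q = trans (sym (*-assoc (2 ^ m) 2 (X 102))) (cong (_* X 102) (*-comm (2 ^ m) 2))

  CONS-BODY : Stmt
  CONS-BODY = LOOP 101 (INC 102 ︔ INC 102) ︔ INC 102 ︔ LOOP 100 DOUBLE

  cons-body-correct : Computes₁ CONS-BODY cons
  cons-body-correct R a b zr = seq (add-twice-correct 102 101 _ (λ ())) (seq inc (Exec-resp-≗ (double-loop-correct a _ refl (zero-at zr 104))
    (Updated-≗ R (100 ∷ 101 ∷ 102 ∷ []) (sym (zero-at zr 100) ∷ sym (zero-at zr 101) ∷ q ∷ []))))
    where
    q : 2 ^ a * suc (R 102 + 2 * b) ≡ cons a b
    q = trans (cong (λ v → 2 ^ a * suc (v + 2 * b)) (zero-at zr 102)) (cong (2 ^ a *_) (+-comm 1 (2 * b)))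

  HALVE : Stmt
  HALVE = LOOP 100 (IFZ 103 (INC 103) (INC 102))

  halve-even-correct : ∀ n X → X 100 ≡ n → X 103 ≡ 0 → Exec HALVE X (X [ 100 ≔ 0 ] [ 102 ≔ X 102 + ⌊ n /2⌋ ] [ 103 ≔ n % 2 ])
  halve-odd-correct : ∀ n X → X 100 ≡ n → X 103 ≡ 1 → Exec HALVE X (X [ 100 ≔ 0 ] [ 102 ≔ X 102 + ⌊ suc n /2⌋ ] [ 103 ≔ suc n % 2 ])
  halve-even-correct zero X z z3 = Exec-resp-≗ (loop0 z) (Updated-≗ X (100 ∷ 102 ∷ 103 ∷ []) (z ∷ sym (+-identityʳ _) ∷ z3 ∷ []))
  halve-even-correct (suc n) X z z3 = loopS z (ifz0 z3 inc) (Exec-resp-≗ (halve-odd-correct n _ refl (cong suc z3)) (Updated-≗ X (100 ∷ 102 ∷ 103 ∷ []) (refl ∷ refl ∷ refl ∷ [])))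
  halve-odd-correct zero X z z3 = Exec-resp-≗ (loop0 z) (Updated-≗ X (100 ∷ 102 ∷ 103 ∷ []) (z ∷ sym (+-identityʳ _) ∷ z3 ∷ []))
  halve-odd-correct (suc n) X z z3 = loopS z (ifzS z3 inc) (Exec-resp-≗ (halve-even-correct n _ refl refl) (Updated-≗ X (100 ∷ 102 ∷ 103 ∷ []) (refl ∷ sym (+-suc (X 102) (⌊ n /2⌋)) ∷ refl ∷ [])))

  -- Each round of LOOP 105 STRIP halves register 100; while the halved value was
  -- even, the half goes back into 100 and 104 counts the round, and the first odd
  -- value 2t+1 stops the loop with t in 106. Run on cons h t this yields h and t.
  STRIP : Stmt
  STRIP = HALVE ︔ IFZ 103 (MOVE 100 102 ︔ INC 104 ︔ INC 105) (MOVE 106 102)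

  strip-correct : ∀ h t X → X 100 ≡ cons h t → X 102 ≡ 0 → X 103 ≡ 0 → X 105 ≡ 1 → X 106 ≡ 0 →
    Exec (LOOP 105 STRIP) X (X [ 100 ≔ 0 ] [ 104 ≔ X 104 + h ] [ 105 ≔ 0 ] [ 106 ≔ t ])
  strip-correct zero t X z0 z2 z3 z5 z6 =
    loopS z5 (seq (halve-even-correct (cons 0 t) _ z0 z3) (ifzS p3 (move-correct 106 102 _ (λ ()))))
      (Exec-resp-≗ (loop0 refl) (Updated-≗ X (100 ∷ 102 ∷ 103 ∷ 104 ∷ 105 ∷ 106 ∷ [])
        (refl ∷ sym z2 ∷ sym z3 ∷ sym (+-identityʳ _) ∷ refl ∷ q ∷ [])))
    where
    p3 : cons 0 t % 2 ≡ 1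
    p3 = trans (cong (_% 2) (cons-zero t)) ([1+2m]%2≡1 t)
    q : X 106 + (X 102 + ⌊ cons 0 t /2⌋) ≡ t
    q = trans (cong₂ (λ u v → u + (v + ⌊ cons 0 t /2⌋)) z6 z2) (trans (cong ⌊_/2⌋ (cons-zero t)) (⌊1+2m/2⌋≡m t))
  strip-correct (suc h) t X z0 z2 z3 z5 z6 =
    loopS z5 (seq (halve-even-correct c _ z0 z3) (ifz0 p3 (seq (move-correct 100 102 _ (λ ())) (seq inc inc))))
      (Exec-resp-≗ (strip-correct h t _ q0 refl p3 refl z6) (Updated-≗ X (100 ∷ 102 ∷ 103 ∷ 104 ∷ 105 ∷ 106 ∷ [])
        (refl ∷ sym z2 ∷ trans p3 (sym z3) ∷ sym (+-suc (X 104) h) ∷ refl ∷ refl ∷ [])))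
    where
    c : ℕ
    c = cons (suc h) t
    p3 : c % 2 ≡ 0
    p3 = trans (cong (_% 2) (cons-suc h t)) (2m%2≡0 (cons h t))
    q0 : 0 + (X 102 + ⌊ c /2⌋) ≡ cons h t
    q0 = trans (cong (λ v → v + ⌊ c /2⌋) z2) (trans (cong ⌊_/2⌋ (cons-suc h t)) (⌊2m/2⌋≡m (cons h t)))

  Uncons : ℕ → ℕ → ℕ → ℕ → Set
  Uncons a b o1 o2 = (a ≡ 0 × o1 ≡ 0 × o2 ≡ 0) ⊎ (a ≡ cons o1 o2)

  UNCONS-BODY : Stmt
  UNCONS-BODY = ZERO 101 ︔ IFZ 100 SKIP (INC 100 ︔ INC 105 ︔ LOOP 105 STRIP ︔ TRANSFER 102 104 ︔ TRANSFER 103 106)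

  uncons-body-correct : Computes₂ UNCONS-BODY Uncons
  uncons-body-correct R a b o1 o2 zr (inj₁ (a0 , e1 , e2)) rewrite a0 | e1 | e2 =
    seq (zero-correct 101 _) (ifz0 refl (Exec-resp-≗ skip (Updated-≗ R (100 ∷ 101 ∷ 102 ∷ 103 ∷ [])
      (sym (zero-at zr 100) ∷ sym (zero-at zr 101) ∷ zero-at zr 102 ∷ zero-at zr 103 ∷ []))))
  uncons-body-correct R a b h t zr (inj₂ ac) =
    seq (zero-correct 101 _) (ifzS (trans ac (sym (suc-π h t))) (seq inc (seq inc
      (seq (strip-correct h t _ (suc-π h t) (zero-at zr 102) (zero-at zr 103) (cong suc (zero-at zr 105)) (zero-at zr 106))
        (seq (transfer-correct 102 104 _ (λ ())) (Exec-resp-≗ (transfer-correct 103 106 _ (λ ())) (Updated-≗ R (100 ∷ 101 ∷ 102 ∷ 103 ∷ 104 ∷ 105 ∷ 106 ∷ [])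
          (sym (zero-at zr 100) ∷ sym (zero-at zr 101) ∷ cong (_+ h) (zero-at zr 104) ∷ refl ∷ sym (zero-at zr 104) ∷ sym (zero-at zr 105) ∷ sym (zero-at zr 106) ∷ []))))))))

module Operations where

  open Structured
  open Frames
  open Macros
  open Calls
  open ArithmeticBodies
  open Pairing
  open import Data.Nat
  open import Data.Nat.Properties
  open import Data.Sum using (inj₂)
  open import Data.Bool using (T; not; true; false)
  open import Relation.Binary.PropositionalEquality

  ≢ᵇ-lit : ∀ a b → T (not (a ≡ᵇ b)) → a ≢ b
  ≢ᵇ-lit a b t refl with a ≡ᵇ a in eq
  ... | true = t
  ... | false = subst T eq (≡⇒≡ᵇ a a refl)

  ADD CONS : ℕ → ℕ → ℕ → Stmt
  ADD d y z = CALL₁ ADD-BODY d y z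
  CONS d y z = CALL₁ CONS-BODY d y z

  UNCONS : ℕ → ℕ → ℕ → Stmt
  UNCONS d1 d2 y = CALL₂ UNCONS-BODY d1 d2 y y

  ASSIGN : ℕ → ℕ → Stmt
  ASSIGN d s = COPY d s 109

  add-correct : ∀ {R} d y z → {T (d <ᵇ 100)} → {T (y <ᵇ 100)} → {T (z <ᵇ 100)} → ZeroFrom 100 R → Exec (ADD d y z) R (R [ d ≔ R y + R z ])
  add-correct d y z {a} {b} {c} zr = call₁-correct add-body-correct (<ᵇ-lit a) (<ᵇ-lit b) (<ᵇ-lit c) zr

  cons-correct : ∀ {R} d y z → {T (d <ᵇ 100)} → {T (y <ᵇ 100)} → {T (z <ᵇ 100)} → ZeroFrom 100 R → Exec (CONS d y z) R (R [ d ≔ cons (R y) (R z) ])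
  cons-correct d y z {a} {b} {c} zr = call₁-correct cons-body-correct (<ᵇ-lit a) (<ᵇ-lit b) (<ᵇ-lit c) zr

  uncons-correct : ∀ {R o1 o2} d1 d2 y → {T (d1 <ᵇ 100)} → {T (d2 <ᵇ 100)} → {T (not (d1 ≡ᵇ d2))} → {T (y <ᵇ 100)} → ZeroFrom 100 R →
    Uncons (R y) (R y) o1 o2 → Exec (UNCONS d1 d2 y) R (R [ d1 ≔ o1 ] [ d2 ≔ o2 ])
  uncons-correct d1 d2 y {a} {b} {c} {e} zr u = call₂-correct uncons-body-correct (<ᵇ-lit a) (<ᵇ-lit b) (≢ᵇ-lit d1 d2 c) (<ᵇ-lit e) (<ᵇ-lit e) zr u

  assign-correct : ∀ {R} d s → {T (d <ᵇ 100)} → {T (s <ᵇ 100)} → {T (not (d ≡ᵇ s))} → ZeroFrom 100 R → Exec (ASSIGN d s) R (R [ d ≔ R s ])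
  assign-correct d s {a} {b} {c} zr = copy-correct d s 109 _ (≢ᵇ-lit d s c) (low≢high 109 (<ᵇ-lit a)) (low≢high 109 (<ᵇ-lit b)) (zr 109 (<ᵇ-lit _))

  uncons-cons-correct : ∀ {R} d1 d2 y o1 o2 → {T (d1 <ᵇ 100)} → {T (d2 <ᵇ 100)} → {T (not (d1 ≡ᵇ d2))} → {T (y <ᵇ 100)} → ZeroFrom 100 R →
    R y ≡ cons o1 o2 → Exec (UNCONS d1 d2 y) R (R [ d1 ≔ o1 ] [ d2 ≔ o2 ])
  uncons-cons-correct d1 d2 y o1 o2 {a} {b} {c} {e} zr h = uncons-correct d1 d2 y {a} {b} {c} {e} zr (inj₂ h)

module RegisterLists where

  open Registers
  open Pairing
  open ArithmeticBodies using (Uncons)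
  open import Data.Nat
  open import Data.Nat.Properties
  open import Data.List using (List; []; _∷_; map)
  open import Data.Maybe using (just; nothing)
  open import Data.Product using (Σ; _×_; _,_; proj₁; proj₂)
  open import Data.Sum using (inj₁; inj₂)
  open import Data.Empty using (⊥-elim)
  open import Relation.Nullary using (Dec; yes; no)
  open import Relation.Binary.PropositionalEquality

  -- Registers of a simulated machine are kept as a list, read as 0 past its end.
  head₀ : List ℕ → ℕ
  head₀ [] = 0
  head₀ (x ∷ _) = x

  tail₀ : List ℕ → List ℕ
  tail₀ [] = []
  tail₀ (_ ∷ xs) = xs

  drop₀ : ℕ → List ℕ → List ℕ
  drop₀ zero L = L
  drop₀ (suc n) L = drop₀ n (tail₀ L)

  lookup₀ : List ℕ → ℕ → ℕ
  lookup₀ L zero = head₀ L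
  lookup₀ L (suc r) = lookup₀ (tail₀ L) r

  update₀ : List ℕ → ℕ → ℕ → List ℕ
  update₀ L zero v = v ∷ tail₀ L
  update₀ L (suc r) v = head₀ L ∷ update₀ (tail₀ L) r v

  reverse-onto : List ℕ → List ℕ → List ℕ
  reverse-onto [] acc = acc
  reverse-onto (x ∷ xs) acc = reverse-onto xs (x ∷ acc)

  -- descend r L [] is a zipper at position r: the suffix of L from r on, and the
  -- entries before r in reverse order.
  descend : ℕ → List ℕ → List ℕ → List ℕ × List ℕ
  descend zero L S = L , S
  descend (suc r) L S = descend r (tail₀ L) (head₀ L ∷ S)

  code-∷ : ∀ x xs → ⌜ x ∷ xs ⌝ ≡ cons x ⌜ xs ⌝
  code-∷ x xs = suc-π x ⌜ xs ⌝

  Uncons-code : ∀ L b → Uncons ⌜ L ⌝ b (head₀ L) ⌜ tail₀ L ⌝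
  Uncons-code [] b = inj₁ (refl , refl , refl)
  Uncons-code (x ∷ xs) b = inj₂ (code-∷ x xs)

  lookup-update-same : ∀ L r v → lookup₀ (update₀ L r v) r ≡ v
  lookup-update-same L zero v = refl
  lookup-update-same L (suc r) v = lookup-update-same (tail₀ L) r v

  lookup-update-other : ∀ L r v i → i ≢ r → lookup₀ (update₀ L r v) i ≡ lookup₀ L i
  lookup-update-other L zero v zero 0≢0 = ⊥-elim (0≢0 refl)
  lookup-update-other L zero v (suc i) _ = refl
  lookup-update-other L (suc r) v zero _ = refl
  lookup-update-other L (suc r) v (suc i) i≢r = lookup-update-other (tail₀ L) r v i (λ i≡r → i≢r (cong suc i≡r))

  Represents : List ℕ → Regs → Set
  Represents L R = ∀ i → R i ≡ lookup₀ L i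

  Represents-upd : ∀ {L R} r v → Represents L R → Represents (update₀ L r v) (R [ r ≔ v ])
  Represents-upd {L} {R} r v rep i = by-cases (i ≟ r)
    where
    by-cases : Dec (i ≡ r) → (R [ r ≔ v ]) i ≡ lookup₀ (update₀ L r v) i
    by-cases (yes refl) = trans (upd-same R i v) (sym (lookup-update-same L i v))
    by-cases (no i≢r) = trans (upd-other R v i≢r) (trans (rep i) (sym (lookup-update-other L r v i i≢r)))

  descend-update : ∀ r L S v → reverse-onto (proj₂ (descend r L S)) (v ∷ tail₀ (proj₁ (descend r L S))) ≡ reverse-onto S (update₀ L r v)
  descend-update zero L S v = refl
  descend-update (suc r) L S v = descend-update r (tail₀ L) (head₀ L ∷ S) v

  descend-lookup : ∀ r L S → head₀ (proj₁ (descend r L S)) ≡ lookup₀ L r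
  descend-lookup zero L S = refl
  descend-lookup (suc r) L S = descend-lookup r (tail₀ L) (head₀ L ∷ S)

  drop₀-[] : ∀ n → drop₀ n [] ≡ []
  drop₀-[] zero = refl
  drop₀-[] (suc n) = drop₀-[] n

  drop₀-past-end : ∀ {A : Set} (f : A → ℕ) n P → P ‼ n ≡ nothing → drop₀ n (map f P) ≡ []
  drop₀-past-end f n [] h = drop₀-[] n
  drop₀-past-end f zero (x ∷ P) ()
  drop₀-past-end f (suc n) (x ∷ P) h = drop₀-past-end f n P h

  drop₀-at : ∀ {A : Set} (f : A → ℕ) n P {a} → P ‼ n ≡ just a → Σ (List ℕ) λ rest → drop₀ n (map f P) ≡ f a ∷ rest
  drop₀-at f n [] ()
  drop₀-at f zero (x ∷ P) refl = map f P , refl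
  drop₀-at f (suc n) (x ∷ P) h = drop₀-at f n P h

  lookup₀-[] : ∀ i → lookup₀ [] i ≡ 0
  lookup₀-[] zero = refl
  lookup₀-[] (suc i) = lookup₀-[] i

  Represents-init : ∀ x → Represents (x ∷ []) (init x)
  Represents-init x zero = refl
  Represents-init x (suc i) = sym (lookup₀-[] i)

  Represents-≗ : ∀ {L R R'} → R ≗ R' → Represents L R → Represents L R'
  Represents-≗ q rep i = trans (sym (q i)) (rep i)

  suc-code-inc : ∀ r j → suc ⌜ inc r j ⌝ᵢ ≡ cons 0 (π r j)
  suc-code-inc r j = sym (cons-zero (π r j))

  suc-code-dec : ∀ r j k → suc ⌜ dec r j k ⌝ᵢ ≡ cons (suc r) (π j k)
  suc-code-dec r j k = sym (trans (cons-suc r (π j k)) (trans (cong (2 *_) (sym (suc-π r (π j k)))) (*-suc 2 (π r (π j k)))))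

module UniversalStep where

  open Registers
  open Structured
  open Frames
  open Macros
  open ArithmeticBodies
  open Pairing
  open Operations
  open RegisterLists
  open import Data.Nat
  open import Data.List using (List; []; _∷_; map)
  open import Data.List.Relation.Unary.All using ([]; _∷_)
  open import Data.Product using (Σ; _×_; _,_; proj₁; proj₂)
  open import Data.Sum using (inj₂)
  open import Data.Bool using (T)
  open import Relation.Binary.PropositionalEquality

  Uncons-code′ : ∀ {c} L b → c ≡ ⌜ L ⌝ → Uncons c b (head₀ L) ⌜ tail₀ L ⌝
  Uncons-code′ L b refl = Uncons-code L b

  DROP-LOOP : Stmt
  DROP-LOOP = LOOP 87 (UNCONS 89 86 86)

  drop-loop-correct : ∀ n L X → X 87 ≡ n → X 86 ≡ ⌜ L ⌝ → ZeroFrom 100 X →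
    Σ ℕ λ j → Exec DROP-LOOP X (X [ 87 ≔ 0 ] [ 89 ≔ j ] [ 86 ≔ ⌜ drop₀ n L ⌝ ])
  drop-loop-correct zero L X z h zr = X 89 , Exec-resp-≗ (loop0 z) (Updated-≗ X (87 ∷ 89 ∷ 86 ∷ []) (z ∷ refl ∷ h ∷ []))
  drop-loop-correct (suc n) L X z h zr =
    let (j , e) = drop-loop-correct n (tail₀ L) (X [ 87 ≔ n ] [ 89 ≔ head₀ L ] [ 86 ≔ ⌜ tail₀ L ⌝ ]) refl refl (ZeroFrom-Updated 100 {X = X} zr)
    in j , loopS z (uncons-correct 89 86 86 (ZeroFrom-Updated 100 {X = X} zr) (Uncons-code′ L (X 86) h)) (Exec-resp-≗ e (Updated-≗ X (87 ∷ 89 ∷ 86 ∷ []) (refl ∷ refl ∷ refl ∷ [])))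

  DESCEND-LOOP : Stmt
  DESCEND-LOOP = LOOP 93 (UNCONS 89 84 84 ︔ CONS 91 89 91)

  descend-loop-correct : ∀ r L S X → X 93 ≡ r → X 84 ≡ ⌜ L ⌝ → X 91 ≡ ⌜ S ⌝ → ZeroFrom 100 X →
    Σ ℕ λ j → Exec DESCEND-LOOP X (X [ 93 ≔ 0 ] [ 89 ≔ j ] [ 84 ≔ ⌜ proj₁ (descend r L S) ⌝ ] [ 91 ≔ ⌜ proj₂ (descend r L S) ⌝ ])
  descend-loop-correct zero L S X z h84 h91 zr = X 89 , Exec-resp-≗ (loop0 z) (Updated-≗ X (93 ∷ 89 ∷ 84 ∷ 91 ∷ []) (z ∷ refl ∷ h84 ∷ h91 ∷ []))
  descend-loop-correct (suc r) L S X z h84 h91 zr =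
    let (j , e) = descend-loop-correct r (tail₀ L) (head₀ L ∷ S) (X [ 93 ≔ r ] [ 89 ≔ head₀ L ] [ 84 ≔ ⌜ tail₀ L ⌝ ] [ 91 ≔ cons (head₀ L) (X 91) ])
                    refl refl (trans (cong (cons (head₀ L)) h91) (sym (code-∷ (head₀ L) S))) (ZeroFrom-Updated 100 {X = X} zr)
    in j , loopS z (seq (uncons-correct 89 84 84 (ZeroFrom-Updated 100 {X = X} zr) (Uncons-code′ L (X 84) h84)) (cons-correct 91 89 91 (ZeroFrom-Updated 100 {X = X} zr)))
             (Exec-resp-≗ e (Updated-≗ X (93 ∷ 89 ∷ 84 ∷ 91 ∷ []) (refl ∷ refl ∷ refl ∷ refl ∷ [])))

  ASCEND-LOOP : Stmt
  ASCEND-LOOP = LOOP 91 (INC 91 ︔ UNCONS 89 91 91 ︔ CONS 84 89 84)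

  ascend-loop-correct : ∀ S L X → X 91 ≡ ⌜ S ⌝ → X 84 ≡ ⌜ L ⌝ → ZeroFrom 100 X →
    Σ ℕ λ j → Exec ASCEND-LOOP X (X [ 91 ≔ 0 ] [ 89 ≔ j ] [ 84 ≔ ⌜ reverse-onto S L ⌝ ])
  ascend-loop-correct [] L X h91 h84 zr = X 89 , Exec-resp-≗ (loop0 h91) (Updated-≗ X (91 ∷ 89 ∷ 84 ∷ []) (h91 ∷ refl ∷ h84 ∷ []))
  ascend-loop-correct (s ∷ S) L X h91 h84 zr =
    let (j , e) = ascend-loop-correct S (s ∷ L) (X [ 91 ≔ π s ⌜ S ⌝ ] [ 91 ≔ suc (π s ⌜ S ⌝) ] [ 89 ≔ s ] [ 91 ≔ ⌜ S ⌝ ] [ 84 ≔ cons s (X 84) ])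
                    refl (trans (cong (cons s) h84) (sym (code-∷ s L))) (ZeroFrom-Updated 100 {X = X} zr)
    in j , loopS h91 (seq inc (seq (uncons-correct 89 91 91 (ZeroFrom-Updated 100 {X = X} zr) (inj₂ (code-∷ s S))) (cons-correct 84 89 84 (ZeroFrom-Updated 100 {X = X} zr))))
             (Exec-resp-≗ e (Updated-≗ X (91 ∷ 89 ∷ 84 ∷ []) (refl ∷ refl ∷ refl ∷ [])))

  DROP DESCEND ASCEND : Stmt
  DROP = DROP-LOOP ︔ ZERO 89
  DESCEND = DESCEND-LOOP ︔ ZERO 89
  ASCEND = ASCEND-LOOP ︔ ZERO 89

  drop-correct : ∀ n L X → X 87 ≡ n → X 86 ≡ ⌜ L ⌝ → ZeroFrom 100 X → Exec DROP X (X [ 87 ≔ 0 ] [ 86 ≔ ⌜ drop₀ n L ⌝ ] [ 89 ≔ 0 ])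
  drop-correct n L X z h zr with drop-loop-correct n L X z h zr
  ... | j , e = seq e (Exec-resp-≗ (zero-correct 89 _) (Updated-≗ X (87 ∷ 89 ∷ 86 ∷ []) (refl ∷ refl ∷ refl ∷ [])))

  descend-correct : ∀ r L S X → X 93 ≡ r → X 84 ≡ ⌜ L ⌝ → X 91 ≡ ⌜ S ⌝ → ZeroFrom 100 X →
    Exec DESCEND X (X [ 93 ≔ 0 ] [ 84 ≔ ⌜ proj₁ (descend r L S) ⌝ ] [ 91 ≔ ⌜ proj₂ (descend r L S) ⌝ ] [ 89 ≔ 0 ])
  descend-correct r L S X z h84 h91 zr with descend-loop-correct r L S X z h84 h91 zr
  ... | j , e = seq e (Exec-resp-≗ (zero-correct 89 _) (Updated-≗ X (93 ∷ 89 ∷ 84 ∷ 91 ∷ []) (refl ∷ refl ∷ refl ∷ refl ∷ [])))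

  ascend-correct : ∀ S L X → X 91 ≡ ⌜ S ⌝ → X 84 ≡ ⌜ L ⌝ → ZeroFrom 100 X → Exec ASCEND X (X [ 91 ≔ 0 ] [ 84 ≔ ⌜ reverse-onto S L ⌝ ] [ 89 ≔ 0 ])
  ascend-correct S L X h91 h84 zr with ascend-loop-correct S L X h91 h84 zr
  ... | j , e = seq e (Exec-resp-≗ (zero-correct 89 _) (Updated-≗ X (91 ∷ 89 ∷ 84 ∷ []) (refl ∷ refl ∷ refl ∷ [])))

  FETCH OUTPUT DECODE EXEC-INC EXEC-DEC EXEC STEP : Stmt
  FETCH = ASSIGN 86 80 ︔ ASSIGN 87 83 ︔ DROP
  OUTPUT = UNCONS 82 90 84
  DECODE = INC 86 ︔ UNCONS 88 90 86 ︔ INC 88 ︔ UNCONS 89 94 88 ︔ INC 94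
  EXEC-INC = UNCONS 93 95 94 ︔ DESCEND ︔ UNCONS 92 84 84 ︔ INC 92 ︔ ASSIGN 83 95 ︔ CONS 84 92 84 ︔ ASCEND
  EXEC-DEC = ASSIGN 93 89 ︔ UNCONS 95 96 94 ︔ DESCEND ︔ UNCONS 92 84 84 ︔ IFZ 92 (ASSIGN 83 96) (ASSIGN 83 95) ︔ CONS 84 92 84 ︔ ASCEND
  EXEC = DECODE ︔ IFZ 89 EXEC-INC EXEC-DEC ︔ INC 85
  STEP = FETCH ︔ IFZ 86 OUTPUT EXEC

  -- The universal machine keeps the code of P in register 80, the program counter
  -- in 83 and the code of the list of P's registers in 84; register 91 is an
  -- empty stack between steps, and 85 is set to 1 by a STEP that executed an
  -- instruction and left at 0 by the STEP that found pc outside P and wrote the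
  -- output into 82.
  record Simulates (P : Program) (pc : ℕ) (Lr : List ℕ) (X : Regs) : Set where
    field
      code-at-80 : X 80 ≡ ⌜ P ⌝ₚ
      pc-at-83 : X 83 ≡ pc
      registers-at-84 : X 84 ≡ ⌜ Lr ⌝
      zero-at-91 : X 91 ≡ 0
      scratch-zero : ZeroFrom 100 X
  open Simulates

  fetch-correct : ∀ {P pc Lr X} → Simulates P pc Lr X →
    Exec FETCH (X [ 85 ≔ 0 ]) (X [ 85 ≔ 0 ] [ 86 ≔ X 80 ] [ 87 ≔ X 83 ] [ 87 ≔ 0 ] [ 86 ≔ ⌜ drop₀ pc (map ⌜_⌝ᵢ P) ⌝ ] [ 89 ≔ 0 ])
  fetch-correct {P} {pc} {Lr} {X} sim =
    seq (assign-correct 86 80 (ZeroFrom-Updated 100 {X = X} (scratch-zero sim))) (seq (assign-correct 87 83 (ZeroFrom-Updated 100 {X = X} (scratch-zero sim)))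
      (drop-correct pc (map ⌜_⌝ᵢ P) _ (pc-at-83 sim) (code-at-80 sim) (ZeroFrom-Updated 100 {X = X} (scratch-zero sim))))

  decode-correct : ∀ {Y ci rest hh rr} → ZeroFrom 100 Y → Y 86 ≡ π ci ⌜ rest ⌝ → suc ci ≡ cons hh rr →
    Exec DECODE Y (Y [ 86 ≔ suc (Y 86) ] [ 88 ≔ ci ] [ 90 ≔ ⌜ rest ⌝ ] [ 88 ≔ suc ci ] [ 89 ≔ hh ] [ 94 ≔ rr ] [ 94 ≔ suc rr ])
  decode-correct {Y} {ci} {rest} zr h e =
    seq inc (seq (uncons-correct 88 90 86 (ZeroFrom-Updated 100 {X = Y} zr) (inj₂ (trans (cong suc h) (code-∷ ci rest))))
      (seq inc (seq (uncons-correct 89 94 88 (ZeroFrom-Updated 100 {X = Y} zr) (inj₂ e)) inc)))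

  suffixAt prefixAt : ℕ → List ℕ → List ℕ
  suffixAt r L = proj₁ (descend r L [])
  prefixAt r L = proj₂ (descend r L [])

  after-fetch : Program → ℕ → Regs → Regs
  after-fetch P pc X = X [ 85 ≔ 0 ] [ 86 ≔ X 80 ] [ 87 ≔ X 83 ] [ 87 ≔ 0 ] [ 86 ≔ ⌜ drop₀ pc (map ⌜_⌝ᵢ P) ⌝ ] [ 89 ≔ 0 ]

  after-decode : Regs → ℕ → List ℕ → ℕ → ℕ → Regs
  after-decode Y ci rest hh rr = Y [ 86 ≔ π ci ⌜ rest ⌝ ] [ 86 ≔ suc (π ci ⌜ rest ⌝) ] [ 88 ≔ ci ] [ 90 ≔ ⌜ rest ⌝ ] [ 88 ≔ suc ci ] [ 89 ≔ hh ] [ 94 ≔ rr ] [ 94 ≔ suc rr ]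

  StepsTo : Program → ℕ → List ℕ → Regs → Set
  StepsTo P pc Lr X = Σ Regs λ W → Exec STEP (X [ 85 ≔ 0 ]) W × Simulates P pc Lr W × W 85 ≡ 1 × (∀ i → i < 80 → W i ≡ X i)

  step-inc-correct : ∀ {P pc Lr X r jj rest} → Simulates P pc Lr X → drop₀ pc (map ⌜_⌝ᵢ P) ≡ ⌜ inc r jj ⌝ᵢ ∷ rest →
    StepsTo P jj (update₀ Lr r (suc (head₀ (suffixAt r Lr)))) X
  step-inc-correct {P} {pc} {Lr} {X} {r} {jj} {rest} sim fetched =
    W , seq (fetch-correct sim) (ifzS (cong ⌜_⌝ fetched) (seq (decode-correct (ZeroFrom-Updated 100 {X = X} (scratch-zero sim)) refl (suc-code-inc r jj))
          (seq (ifz0 refl exec-inc) inc)))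
      , record { code-at-80 = code-at-80 sim ; pc-at-83 = refl ; registers-at-84 = cong ⌜_⌝ (descend-update r Lr [] v) ; zero-at-91 = refl ; scratch-zero = ZeroFrom-Updated 100 {X = X} (scratch-zero sim) }
      , refl , Updated-below {X = X} 80
    where
    ci = ⌜ inc r jj ⌝ᵢ
    Y = after-decode (after-fetch P pc X) ci rest 0 (π r jj)
    L' = suffixAt r Lr
    S' = prefixAt r Lr
    v = suc (head₀ L')
    W1 = Y [ 93 ≔ r ] [ 95 ≔ jj ] [ 93 ≔ 0 ] [ 84 ≔ ⌜ L' ⌝ ] [ 91 ≔ ⌜ S' ⌝ ] [ 89 ≔ 0 ] [ 92 ≔ head₀ L' ] [ 84 ≔ ⌜ tail₀ L' ⌝ ]
           [ 92 ≔ v ] [ 83 ≔ jj ] [ 84 ≔ cons v ⌜ tail₀ L' ⌝ ]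
    W2 = W1 [ 91 ≔ 0 ] [ 84 ≔ ⌜ reverse-onto S' (v ∷ tail₀ L') ⌝ ] [ 89 ≔ 0 ]
    W = W2 [ 85 ≔ suc (W2 85) ]
    scratch : ∀ {A} {{c : Updated X A}} → {T (all<ᵇ 100 (updated-keys c))} → ZeroFrom 100 A
    scratch {{c}} {t} = ZeroFrom-Updated 100 {{c}} {t} (scratch-zero sim)
    exec-inc : Exec EXEC-INC Y W2
    exec-inc = seq (uncons-correct 93 95 94 scratch (inj₂ (suc-π r jj))) (seq (descend-correct r Lr [] _ refl (registers-at-84 sim) (zero-at-91 sim) scratch)
           (seq (uncons-correct 92 84 84 scratch (Uncons-code′ L' ⌜ L' ⌝ refl)) (seq inc (seq (assign-correct 83 95 scratch) (seq (cons-correct 84 92 84 scratch)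
             (ascend-correct S' (v ∷ tail₀ L') _ refl (sym (code-∷ v (tail₀ L'))) scratch))))))

  step-dec-correct : ∀ {P pc Lr X r jj kk rest} → Simulates P pc Lr X → drop₀ pc (map ⌜_⌝ᵢ P) ≡ ⌜ dec r jj kk ⌝ᵢ ∷ rest →
    (head₀ (suffixAt r Lr) ≡ 0 → StepsTo P kk (update₀ Lr r (head₀ (suffixAt r Lr))) X) ×
    (∀ m → head₀ (suffixAt r Lr) ≡ suc m → StepsTo P jj (update₀ Lr r m) X)
  step-dec-correct {P} {pc} {Lr} {X} {r} {jj} {kk} {rest} sim fetched = case0 , caseS
    where
    ci = ⌜ dec r jj kk ⌝ᵢ
    Y = after-decode (after-fetch P pc X) ci rest (suc r) (π jj kk) [ 89 ≔ r ]
    L' = suffixAt r Lr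
    S' = prefixAt r Lr
    scratch : ∀ {A} {{c : Updated X A}} → {T (all<ᵇ 100 (updated-keys c))} → ZeroFrom 100 A
    scratch {{c}} {t} = ZeroFrom-Updated 100 {{c}} {t} (scratch-zero sim)
    Ym = Y [ 93 ≔ r ] [ 95 ≔ jj ] [ 96 ≔ kk ] [ 93 ≔ 0 ] [ 84 ≔ ⌜ L' ⌝ ] [ 91 ≔ ⌜ S' ⌝ ] [ 89 ≔ 0 ] [ 92 ≔ head₀ L' ] [ 84 ≔ ⌜ tail₀ L' ⌝ ]
    through-descent : ∀ {W} → Exec (IFZ 92 (ASSIGN 83 96) (ASSIGN 83 95) ︔ CONS 84 92 84 ︔ ASCEND) Ym W → Exec EXEC-DEC Y W
    through-descent rest = seq (assign-correct 93 89 scratch) (seq (uncons-correct 95 96 94 scratch (inj₂ (suc-π jj kk))) (seq (descend-correct r Lr [] _ refl (registers-at-84 sim) (zero-at-91 sim) scratch)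
            (seq (uncons-correct 92 84 84 scratch (Uncons-code′ L' ⌜ L' ⌝ refl)) rest)))
    case0 : head₀ L' ≡ 0 → StepsTo P kk (update₀ Lr r (head₀ L')) X
    case0 h0 = W , seq (fetch-correct sim) (ifzS (cong ⌜_⌝ fetched) (seq (decode-correct (ZeroFrom-Updated 100 {X = X} (scratch-zero sim)) refl (suc-code-dec r jj kk))
          (seq (ifzS refl exec-dec) inc)))
      , record { code-at-80 = code-at-80 sim ; pc-at-83 = refl ; registers-at-84 = cong ⌜_⌝ (descend-update r Lr [] v) ; zero-at-91 = refl ; scratch-zero = scratch }
      , refl , Updated-below {X = X} 80
      where
      v = head₀ L'
      W2 = Ym [ 83 ≔ kk ] [ 84 ≔ cons v ⌜ tail₀ L' ⌝ ] [ 91 ≔ 0 ] [ 84 ≔ ⌜ reverse-onto S' (v ∷ tail₀ L') ⌝ ] [ 89 ≔ 0 ]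
      W = W2 [ 85 ≔ suc (W2 85) ]
      exec-dec : Exec EXEC-DEC Y W2
      exec-dec = through-descent (seq (ifz0 h0 (assign-correct 83 96 scratch)) (seq (cons-correct 84 92 84 scratch) (ascend-correct S' (v ∷ tail₀ L') _ refl (sym (code-∷ v (tail₀ L'))) scratch)))
    caseS : ∀ m → head₀ L' ≡ suc m → StepsTo P jj (update₀ Lr r m) X
    caseS m h0 = W , seq (fetch-correct sim) (ifzS (cong ⌜_⌝ fetched) (seq (decode-correct (ZeroFrom-Updated 100 {X = X} (scratch-zero sim)) refl (suc-code-dec r jj kk))
          (seq (ifzS refl exec-dec) inc)))
      , record { code-at-80 = code-at-80 sim ; pc-at-83 = refl ; registers-at-84 = cong ⌜_⌝ (descend-update r Lr [] m) ; zero-at-91 = refl ; scratch-zero = scratch }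
      , refl , Updated-below {X = X} 80
      where
      W2 = Ym [ 92 ≔ m ] [ 83 ≔ jj ] [ 84 ≔ cons m ⌜ tail₀ L' ⌝ ] [ 91 ≔ 0 ] [ 84 ≔ ⌜ reverse-onto S' (m ∷ tail₀ L') ⌝ ] [ 89 ≔ 0 ]
      W = W2 [ 85 ≔ suc (W2 85) ]
      exec-dec : Exec EXEC-DEC Y W2
      exec-dec = through-descent (seq (ifzS h0 (assign-correct 83 95 scratch)) (seq (cons-correct 84 92 84 scratch) (ascend-correct S' (m ∷ tail₀ L') _ refl (sym (code-∷ m (tail₀ L'))) scratch)))

  step-halt-correct : ∀ {P pc Lr X} → Simulates P pc Lr X → drop₀ pc (map ⌜_⌝ᵢ P) ≡ [] →
    Σ Regs λ W → Exec STEP (X [ 85 ≔ 0 ]) W × W 85 ≡ 0 × W 82 ≡ head₀ Lr × ZeroFrom 100 W × (∀ i → i < 80 → W i ≡ X i)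
  step-halt-correct {P} {pc} {Lr} {X} sim fetched =
    after-fetch P pc X [ 82 ≔ head₀ Lr ] [ 90 ≔ ⌜ tail₀ Lr ⌝ ] ,
    seq (fetch-correct sim) (ifz0 (cong ⌜_⌝ fetched) (uncons-correct 82 90 84 (ZeroFrom-Updated 100 {X = X} (scratch-zero sim)) (Uncons-code′ Lr (X 84) (registers-at-84 sim)))) ,
    refl , refl , ZeroFrom-Updated 100 {X = X} (scratch-zero sim) , Updated-below {X = X} 80

  Represents-inc : ∀ {Lr Rs} r → Represents Lr Rs → Represents (update₀ Lr r (suc (head₀ (suffixAt r Lr)))) (Rs [ r ≔ suc (Rs r) ])
  Represents-inc {Lr} {Rs} r rep = subst (λ u → Represents (update₀ Lr r (suc u)) (Rs [ r ≔ suc (Rs r) ])) (trans (rep r) (sym (descend-lookup r Lr [])))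
    (Represents-upd r (suc (Rs r)) rep)

  Represents-dec0 : ∀ {Lr Rs} r → Represents Lr Rs → Represents (update₀ Lr r (head₀ (suffixAt r Lr))) Rs
  Represents-dec0 {Lr} {Rs} r rep = subst (λ u → Represents (update₀ Lr r u) Rs) (trans (rep r) (sym (descend-lookup r Lr [])))
    (Represents-≗ (upd-id Rs r (Rs r) refl) (Represents-upd r (Rs r) rep))

module UniversalLoop where

  open Structured
  open Frames
  open RegisterLists
  open import Data.Nat
  open import Data.List using ([])
  open import Data.Product using (Σ; _×_; _,_; proj₁; proj₂)
  open import Relation.Binary.PropositionalEquality

  open UniversalStep

  SimulationHalts : Program → Regs → ℕ → Set
  SimulationHalts P X y = Σ Regs λ X' → Exec (LOOP 85 STEP) X X' × X' 82 ≡ y × (∀ i → i < 80 → X' i ≡ X i) × ZeroFrom 100 X'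

  step-then : ∀ {P pc Lr X y} → X 85 ≡ 1 → StepsTo P pc Lr X → (∀ W → Simulates P pc Lr W → W 85 ≡ 1 → SimulationHalts P W y) → SimulationHalts P X y
  step-then z85 (W , e , sim' , w85 , fr) k with k W sim' w85
  ... | X' , e' , o , fr' , z' = X' , loopS z85 e e' , o , (λ i lt → trans (fr' i lt) (fr i lt)) , z'

  simulate : ∀ {P pc Rs y} → Run P pc Rs y → ∀ Lr X → Represents Lr Rs → Simulates P pc Lr X → X 85 ≡ 1 → SimulationHalts P X y
  simulate {P} {pc} (halt h) Lr X rep sim z85 with step-halt-correct sim (drop₀-past-end ⌜_⌝ᵢ pc P h)
  ... | W , e , w85 , w82 , wz , fr = W , loopS z85 e (loop0 w85) , trans w82 (sym (rep 0)) , fr , wz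
  simulate {P} {pc} {Rs} (step-inc {r = r} h rn) Lr X rep sim z85 =
    step-then z85 (step-inc-correct sim (proj₂ (drop₀-at ⌜_⌝ᵢ pc P h))) (λ W sim' w85 → simulate rn _ W (Represents-inc r rep) sim' w85)
  simulate {P} {pc} {Rs} (step-dec0 {r = r} {j = j} {k = k} h z rn) Lr X rep sim z85 =
    step-then z85 (proj₁ (step-dec-correct {jj = j} {kk = k} sim (proj₂ (drop₀-at ⌜_⌝ᵢ pc P h))) (trans (descend-lookup r Lr []) (trans (sym (rep r)) z)))
      (λ W sim' w85 → simulate rn _ W (Represents-dec0 r rep) sim' w85)
  simulate {P} {pc} {Rs} (step-decS {r = r} {j = j} {k = k} {m = m} h z rn) Lr X rep sim z85 =
    step-then z85 (proj₂ (step-dec-correct {jj = j} {kk = k} sim (proj₂ (drop₀-at ⌜_⌝ᵢ pc P h))) m (trans (descend-lookup r Lr []) (trans (sym (rep r)) z)))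
      (λ W sim' w85 → simulate rn _ W (Represents-upd r m rep) sim' w85)

module Universal where

  open Registers
  open Structured
  open Frames
  open Macros
  open Calls
  open Pairing
  open Operations
  open RegisterLists
  open UniversalStep
  open UniversalLoop
  open import Data.Nat
  open import Data.Nat.Properties
  open import Data.List using (List; []; _∷_)
  open import Data.List.Relation.Unary.All using (All; []; _∷_)
  open import Data.Product using (_,_)
  open import Data.Bool using (T; true; false; not)
  open import Data.Empty using (⊥-elim)
  open import Relation.Nullary using (yes; no)
  open import Relation.Binary.PropositionalEquality

  ZEROS : List ℕ → Stmt
  ZEROS [] = SKIP
  ZEROS (k ∷ ks) = ZERO k ︔ ZEROS ks

  zero-all : Regs → List ℕ → Regs
  zero-all R [] = R
  zero-all R (k ∷ ks) = zero-all (R [ k ≔ 0 ]) ks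

  zeros-correct : ∀ ks R → Exec (ZEROS ks) R (zero-all R ks)
  zeros-correct [] R = skip
  zeros-correct (k ∷ ks) R = seq (zero-correct k R) (zeros-correct ks _)

  zero-all-other : ∀ ks R i → All (i ≢_) ks → zero-all R ks i ≡ R i
  zero-all-other [] R i _ = refl
  zero-all-other (k ∷ ks) R i (p ∷ ps) = trans (zero-all-other ks _ i ps) (upd-other R 0 p)

  range : ℕ → ℕ → List ℕ
  range a zero = []
  range a (suc n) = a ∷ range (suc a) n

  range-cases : ∀ {P : ℕ → Set} a n → All P (range a n) → ∀ i → a ≤ i → i < a + n → P i
  range-cases a zero [] i le lt = ⊥-elim (<⇒≱ lt (subst (_≤ i) (sym (+-identityʳ a)) le))
  range-cases {P} a (suc n) (p ∷ ps) i le lt with a ≟ i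
  ... | yes refl = p
  ... | no ne = range-cases (suc a) n ps i (≤∧≢⇒< le ne) (subst (i <_) (+-suc a n) lt)

  universal-scratch : List ℕ
  universal-scratch = 80 ∷ 81 ∷ range 83 17

  UNIV-BODY : Stmt
  UNIV-BODY = CONS 84 81 99 ︔ INC 85 ︔ LOOP 85 STEP ︔ ZEROS universal-scratch

  univ-body-correct : ∀ {R P x y c} → ZeroFrom 80 R → c ≡ ⌜ P ⌝ₚ → Run P 0 (init x) y → Exec UNIV-BODY (R [ 80 ≔ c ] [ 81 ≔ x ]) (R [ 82 ≔ y ])
  univ-body-correct {R} {P} {x} {y} {c} z80 ce run with simulate run (x ∷ []) X2 (Represents-init x) sim (cong suc (z80 85 (<ᵇ-lit _)))
    where
    z100 : ZeroFrom 100 R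
    z100 = ZeroFrom-mono (<ᵇ-lit _) z80
    X2 = R [ 80 ≔ c ] [ 81 ≔ x ] [ 84 ≔ cons x (R 99) ] [ 85 ≔ suc (R 85) ]
    sim : Simulates P 0 (x ∷ []) X2
    sim = record { code-at-80 = ce ; pc-at-83 = z80 83 (<ᵇ-lit _) ; registers-at-84 = trans (cong (cons x) (z80 99 (<ᵇ-lit _))) (sym (code-∷ x [])) ;
                   zero-at-91 = z80 91 (<ᵇ-lit _) ; scratch-zero = ZeroFrom-Updated 100 {X = R} z100 }
  ... | X' , eL , o , fr , z' =
    seq (cons-correct 84 81 99 (ZeroFrom-Updated 100 {X = R} (ZeroFrom-mono (<ᵇ-lit _) z80))) (seq inc (seq eL (Exec-resp-≗ (zeros-correct universal-scratch X') restored)))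
    where
    restored : zero-all X' universal-scratch ≗ (R [ 82 ≔ y ])
    restored i with i <? 80
    ... | yes lt = trans (zero-all-other universal-scratch X' i (all≥ᵇ⇒All≢ 80 i universal-scratch _ lt)) (trans (fr i lt)
                     (trans (Updated-below {X = R} 80 i lt) (sym (upd-other R y (λ e → <⇒≱ lt (subst (80 ≤_) (sym e) (<ᵇ-lit _)))))))
    ... | no ge with 100 ≤? i
    ... | yes le = trans (zero-all-other universal-scratch X' i (all<ᵇ⇒All≢ 100 i universal-scratch _ le)) (trans (z' i le)
                     (sym (trans (upd-other R y (λ e → <⇒≱ (<ᵇ-lit {82} {100} _) (subst (100 ≤_) e le))) (z80 i (≤-trans (<ᵇ-lit _) le)))))
    ... | no nle = range-cases {λ i → zero-all X' universal-scratch i ≡ (R [ 82 ≔ y ]) i} 80 20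
           (sym (zz 80) ∷ sym (zz 81) ∷ o ∷ sym (zz 83) ∷ sym (zz 84) ∷ sym (zz 85) ∷ sym (zz 86) ∷ sym (zz 87) ∷ sym (zz 88) ∷ sym (zz 89) ∷
            sym (zz 90) ∷ sym (zz 91) ∷ sym (zz 92) ∷ sym (zz 93) ∷ sym (zz 94) ∷ sym (zz 95) ∷ sym (zz 96) ∷ sym (zz 97) ∷ sym (zz 98) ∷ sym (zz 99) ∷ [])
           i (≮⇒≥ ge) (≰⇒> nle)
      where
      zz : ∀ k → {T (79 <ᵇ k)} → R k ≡ 0
      zz k {t} = z80 k (<ᵇ-lit t)

  UNIV : ℕ → ℕ → ℕ → Stmt
  UNIV d e x = ASSIGN 80 e ︔ ASSIGN 81 x ︔ UNIV-BODY ︔ TRANSFER d 82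

  univ-correct : ∀ {R P y} d e x → {T (d <ᵇ 80)} → {T (e <ᵇ 80)} → {T (x <ᵇ 80)} → ZeroFrom 80 R →
    R e ≡ ⌜ P ⌝ₚ → Run P 0 (init (R x)) y → Exec (UNIV d e x) R (R [ d ≔ y ])
  univ-correct {R} {P} {y} d e x {td} {te} {tx} z80 ce run =
    seq (assign-correct 80 e {_} {lt' {e} te} {ne' {e} {80} te} (ZeroFrom-mono (<ᵇ-lit _) z80))
      (seq (assign-correct 81 x {_} {lt' {x} tx} {ne' {x} {81} tx} (ZeroFrom-Updated 100 {X = R} (ZeroFrom-mono (<ᵇ-lit _) z80)))
        (seq (univ-body-correct z80 ce (subst (λ v → Run P 0 (init v) y) (sym (upd-other R (R e) xne)) run)) (Exec-resp-≗ (transfer-correct d 82 _ dne) (≗-by₂ d 82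
          (trans (upd-same _ d _) (trans (upd-same R 82 y) (sym (upd-same R d y))))
          (trans (upd-other _ _ {82} (λ (e : 82 ≡ d) → dne (sym e))) (trans (upd-same (R [ 82 ≔ y ]) 82 0) (sym (trans (upd-other R y (λ (e : 82 ≡ d) → dne (sym e))) (z80 82 (<ᵇ-lit _))))))
          (λ i n1 n2 → trans (upd-other _ _ n1) (trans (upd-other _ _ n2) (trans (upd-other R _ n2) (sym (upd-other R _ n1)))))))))
    where
    dlt : d < 80
    dlt = <ᵇ-lit td
    dne : d ≢ 82
    xne : x ≢ 80
    xne e = <⇒≱ (<ᵇ-lit tx) (subst (80 ≤_) (sym e) (<ᵇ-lit _))
    dne e = <⇒≱ dlt (subst (80 ≤_) (sym e) (<ᵇ-lit _))
    lt' : ∀ {k} → T (k <ᵇ 80) → T (k <ᵇ 100)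
    lt' {k} t = <⇒<ᵇ (≤-trans (<ᵇ-lit {k} {80} t) (<ᵇ-lit {79} {100} _))
    ne' : ∀ {k j} → T (k <ᵇ 80) → {T (79 <ᵇ j)} → T (not (j ≡ᵇ k))
    ne' {k} {j} t {u} with j ≡ᵇ k in eq
    ... | true = <⇒≱ (<ᵇ-lit t) (subst (80 ≤_) (≡ᵇ⇒≡ j k (subst T (sym eq) _)) (<ᵇ-lit u))
    ... | false = _

module Parameterisation where

  open Registers
  open Structured
  open import Data.Nat
  open import Data.Nat.Properties
  open import Data.List using (List; []; _∷_; _++_; length)
  open import Data.List.Properties using (length-++)
  open import Data.Maybe using (nothing)
  open import Data.Product using (_,_)
  open import Relation.Binary.PropositionalEquality

  -- with-parameter s c runs s with c added to register 1. The loader (c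
  -- increments of register 1) is entered twice, dispatching on register 2: with
  -- register 2 = 0 it continues into s, and s ends by setting register 2 to 1,
  -- after which the loader exits the program. So s must leave register 2 at 0.
  loader : ℕ → ℕ → List Instr
  loader p zero = dec 2 (suc p) 1 ∷ []
  loader p (suc n) = inc 1 (suc p) ∷ loader (suc p) n

  loader-start : Stmt → ℕ
  loader-start s = suc (size s + 1)

  prefix : Stmt → List Instr
  prefix s = dec 2 1 (loader-start s) ∷ (compile s 1 ++ (inc 2 (loader-start s) ∷ []))

  with-parameter : Stmt → ℕ → List Instr
  with-parameter s c = prefix s ++ loader (loader-start s) c

  -- Both codes are opaque so that codes of concrete programs are never normalised.
  opaque
    smn : Stmt → ℕ → ℕ
    smn s c = ⌜ with-parameter s c ⌝ₚ

    smn-def : ∀ s c → smn s c ≡ ⌜ with-parameter s c ⌝ₚ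
    smn-def s c = refl

  opaque
    code : Program → ℕ
    code P = ⌜ P ⌝ₚ

    code-def : ∀ P → code P ≡ ⌜ P ⌝ₚ
    code-def P = refl

  loader-length : ∀ p n → length (loader p n) ≡ suc n
  loader-length p zero = refl
  loader-length p (suc n) = cong suc (loader-length (suc p) n)

  prefix-length : ∀ s → length (prefix s) ≡ loader-start s
  prefix-length s = cong suc (trans (length-++ (compile s 1)) (cong (_+ 1) (compile-length s 1)))

  loader-load : ∀ n p {P R y} → Placed P p (loader p n) → R 2 ≡ 0 → Run P 1 (R [ 1 ≔ R 1 + n ]) y → Run P p R y
  loader-load zero p {R = R} a z r = step-dec0 (Placed-head a) z (Run-resp-≗ (λ i → upd-id R 1 _ (sym (+-identityʳ (R 1))) i) r)
  loader-load (suc n) p {R = R} a z r = step-inc (Placed-head a) (loader-load n (suc p) (Placed-tail a) z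
    (Run-resp-≗ (λ i → trans (cong (λ v → (R [ 1 ≔ v ]) i) (+-suc (R 1) n)) (sym (upd-idem R 1 _ _ i))) r))

  loader-exit : ∀ n p {P R} → Placed P p (loader p n) → R 2 ≡ 1 → (∀ q → q ≡ suc (p + n) → P ‼ q ≡ nothing) → Run P p R (R 0)
  loader-exit zero p {P} {R} a z h = step-decS (Placed-head a) z (halt (h (suc p) (cong suc (sym (+-identityʳ p)))))
  loader-exit (suc n) p {P} {R} a z h = step-inc (Placed-head a) (loader-exit n (suc p) (Placed-tail a) z (λ q e → h q (trans e (cong suc (sym (+-suc p n))))))

  smn-correct : ∀ s c x R2 → Exec s (init x [ 1 ≔ c ]) R2 → R2 2 ≡ 0 → smn s c ∙ x ↓ R2 0
  smn-correct s c x R2 e z = with-parameter s c , smn-def s c ,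
    step-dec0 (Placed-head a0) refl
      (loader-load c (loader-start s) aL refl
        (compile-correct e (Placed-++ˡ (compile s 1) _ (Placed-tail (Placed-++ˡ (prefix s) _ a0)))
          (step-inc (Placed-head (Placed-++ʳ (compile s 1) _ (cong suc (compile-length s 1)) (Placed-tail (Placed-++ˡ (prefix s) _ a0))))
            (loader-exit c (loader-start s) aL (cong suc z) hl))))
    where
    P = with-parameter s c
    a0 : Placed P 0 P
    a0 = Placed-self P
    aL : Placed P (loader-start s) (loader (loader-start s) c)
    aL = Placed-++ʳ (prefix s) _ (prefix-length s) a0
    lenP : length P ≡ suc (loader-start s + c)
    lenP = trans (length-++ (prefix s)) (trans (cong₂ _+_ (prefix-length s) (loader-length (loader-start s) c)) (+-suc (loader-start s) c))
    hl : ∀ q → q ≡ suc (loader-start s + c) → P ‼ q ≡ nothing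
    hl q e = trans (cong (P ‼_) (trans e (sym lenP))) (‼-length P)

module CodeEmission where

  open Registers
  open Structured
  open Frames
  open Macros
  open Pairing
  open Operations
  open RegisterLists using (code-∷)
  open Parameterisation
  open import Data.Nat
  open import Data.Nat.Properties
  open import Data.List using (List; []; _∷_; _++_; map)
  open import Data.List.Relation.Unary.All using ([]; _∷_)
  open import Data.Product using (Σ; _,_)
  open import Relation.Binary.PropositionalEquality

  INCS : ℕ → ℕ → Stmt
  INCS d zero = SKIP
  INCS d (suc n) = INC d ︔ INCS d n

  CONST : ℕ → ℕ → Stmt
  CONST d n = ZERO d ︔ INCS d n

  incs-correct : ∀ d n R → Exec (INCS d n) R (R [ d ≔ R d + n ])
  incs-correct d zero R = Exec-resp-≗ skip (λ i → sym (upd-id R d _ (sym (+-identityʳ (R d))) i))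
  incs-correct d (suc n) R = seq inc (Exec-resp-≗ (incs-correct d n _) (λ i → trans (upd-idem R d _ _ i)
    (cong (λ v → (R [ d ≔ v ]) i) (trans (cong (_+ n) (upd-same R d _)) (sym (+-suc (R d) n))))))

  const-correct : ∀ d n R → Exec (CONST d n) R (R [ d ≔ n ])
  const-correct d n R = seq (zero-correct d R) (Exec-resp-≗ (incs-correct d n _) (λ i → trans (upd-idem R d _ _ i)
    (cong (λ v → (R [ d ≔ v ]) i) (cong (_+ n) (upd-same R d 0)))))

  m+m≡2m : ∀ m → m + m ≡ 2 * m
  m+m≡2m m = cong (m +_) (sym (+-identityʳ m))

  -- Register 63 accumulates the code of a program from its last instruction
  -- backwards. EMIT-LOADER prepends the increments of loader p m, whose number m
  -- is only known at run time; an increment's code ⌜ inc 1 q ⌝ᵢ = 2 π 1 q is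
  -- computed as (cons 1 q ∸ 1) + (cons 1 q ∸ 1).
  EMIT-LOADER : Stmt
  EMIT-LOADER = LOOP 62 (CONS 64 60 61 ︔ PRED 64 ︔ ADD 64 64 64 ︔ CONS 63 64 63 ︔ PRED 61)

  emit-loader-correct : ∀ m k p X → X 62 ≡ m → X 60 ≡ 1 → X 61 ≡ p + m → X 63 ≡ ⌜ map ⌜_⌝ᵢ (loader (p + m) k) ⌝ → ZeroFrom 100 X →
    Σ ℕ λ t → Exec EMIT-LOADER X (X [ 62 ≔ 0 ] [ 64 ≔ t ] [ 63 ≔ ⌜ map ⌜_⌝ᵢ (loader p (m + k)) ⌝ ] [ 61 ≔ p ])
  emit-loader-correct zero k p X z h60 h61 h63 zr = X 64 , Exec-resp-≗ (loop0 z) (Updated-≗ X (62 ∷ 64 ∷ 63 ∷ 61 ∷ [])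
    (z ∷ refl ∷ trans h63 (cong (λ q → ⌜ map ⌜_⌝ᵢ (loader q k) ⌝) (+-identityʳ p)) ∷ trans h61 (+-identityʳ p) ∷ []))
  emit-loader-correct (suc m) k p X z h60 h61 h63 zr =
    let (t , e) = emit-loader-correct m (suc k) p X5 refl h60 q61 q63 (ZeroFrom-Updated 100 {X = X} zr)
    in t , loopS z (seq (cons-correct 64 60 61 (ZeroFrom-Updated 100 {X = X} zr)) (seq (pred-correct 64 _) (seq (add-correct 64 64 64 (ZeroFrom-Updated 100 {X = X} zr))
             (seq (cons-correct 63 64 63 (ZeroFrom-Updated 100 {X = X} zr)) (pred-correct 61 _)))))
         (Exec-resp-≗ e (Updated-≗ X (62 ∷ 64 ∷ 63 ∷ 61 ∷ []) (refl ∷ refl ∷ cong (λ n → ⌜ map ⌜_⌝ᵢ (loader p n) ⌝) (+-suc m k) ∷ refl ∷ [])))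
    where
    pv = pred (cons (X 60) (X 61))
    X5 = X [ 62 ≔ m ] [ 64 ≔ cons (X 60) (X 61) ] [ 64 ≔ pv ] [ 64 ≔ pv + pv ] [ 63 ≔ cons (pv + pv) (X 63) ] [ 61 ≔ pred (X 61) ]
    ps : p + suc m ≡ suc (p + m)
    ps = +-suc p m
    q61 : pred (X 61) ≡ p + m
    q61 = cong pred (trans h61 ps)
    qpv : pv ≡ π 1 (suc (p + m))
    qpv = trans (cong pred (cong₂ cons h60 (trans h61 ps))) (cong pred (sym (suc-π 1 (suc (p + m)))))
    q63 : cons (pv + pv) (X 63) ≡ ⌜ map ⌜_⌝ᵢ (loader (p + m) (suc k)) ⌝
    q63 = trans (cong₂ cons (trans (m+m≡2m pv) (cong (2 *_) qpv)) (trans h63 (cong (λ q → ⌜ map ⌜_⌝ᵢ (loader q k) ⌝) ps)))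
            (sym (code-∷ ⌜ inc 1 (suc (p + m)) ⌝ᵢ (map ⌜_⌝ᵢ (loader (suc (p + m)) k))))

  EMIT : List Instr → Stmt
  EMIT [] = SKIP
  EMIT (i ∷ is) = EMIT is ︔ CONST 64 ⌜ i ⌝ᵢ ︔ CONS 63 64 63

  emit-correct : ∀ is ys X → X 63 ≡ ⌜ map ⌜_⌝ᵢ ys ⌝ → ZeroFrom 100 X → Σ ℕ λ t → Exec (EMIT is) X (X [ 64 ≔ t ] [ 63 ≔ ⌜ map ⌜_⌝ᵢ (is ++ ys) ⌝ ])
  emit-correct [] ys X h zr = X 64 , Exec-resp-≗ skip (Updated-≗ X (64 ∷ 63 ∷ []) (refl ∷ h ∷ []))
  emit-correct (i ∷ is) ys X h zr =
    let (t , e) = emit-correct is ys X h zr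
    in ⌜ i ⌝ᵢ , seq e (seq (const-correct 64 ⌜ i ⌝ᵢ _) (Exec-resp-≗ (cons-correct 63 64 63 (ZeroFrom-Updated 100 {X = X} zr))
           (Updated-≗ X (64 ∷ 63 ∷ []) (refl ∷ sym (code-∷ ⌜ i ⌝ᵢ (map ⌜_⌝ᵢ (is ++ ys))) ∷ []))))

module SmnBody where

  open Structured
  open Frames
  open Macros
  open Pairing
  open Operations
  open RegisterLists using (code-∷)
  open Parameterisation
  open Universal using (ZEROS; zeros-correct)
  open import Data.Nat
  open import Data.Nat.Properties
  open import Data.List using ([]; _∷_; _++_; map)
  open import Data.List.Relation.Unary.All using ([]; _∷_)
  open import Data.Product using (Σ; _,_)
  open import Data.Bool using (T)
  open import Relation.Binary.PropositionalEquality

  open CodeEmission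

  -- Emits the final instruction dec 2 j 1 of loader (loader-start s) c, with
  -- j = 1 + loader-start s + c just past the program; its code is
  -- 2 π 2 (π j 1) + 1.
  EMIT-LOADER-END : Stmt → Stmt
  EMIT-LOADER-END s = CONST 60 1 ︔ CONST 61 (loader-start s) ︔ ADD 61 61 62 ︔ ASSIGN 64 61 ︔ INC 64 ︔ CONS 65 64 60 ︔ PRED 65 ︔ CONST 66 2 ︔
    CONS 67 66 65 ︔ PRED 67 ︔ ADD 67 67 67 ︔ INC 67 ︔ ZERO 64 ︔ CONS 63 67 64

  module _ (s : Stmt) (R : Regs) (cv : ℕ) where
    L = loader-start s
    j = suc (L + cv)
    u = pred (cons j 1)
    w = pred (cons 2 u)
    after-loader-end : Regs
    after-loader-end = R [ 62 ≔ cv ] [ 60 ≔ 1 ] [ 61 ≔ L ] [ 61 ≔ L + cv ] [ 64 ≔ L + cv ] [ 64 ≔ j ] [ 65 ≔ cons j 1 ] [ 65 ≔ u ] [ 66 ≔ 2 ]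
          [ 67 ≔ cons 2 u ] [ 67 ≔ w ] [ 67 ≔ w + w ] [ 67 ≔ suc (w + w) ] [ 64 ≔ 0 ] [ 63 ≔ cons (suc (w + w)) 0 ]

    emit-loader-end-correct : ZeroFrom 40 R → Exec (EMIT-LOADER-END s) (R [ 62 ≔ cv ]) after-loader-end
    emit-loader-end-correct z40 = seq (const-correct 60 1 _) (seq (const-correct 61 L _) (seq (add-correct 61 61 62 (ZeroFrom-Updated 100 {X = R} z100)) (seq (assign-correct 64 61 (ZeroFrom-Updated 100 {X = R} z100))
       (seq inc (seq (cons-correct 65 64 60 (ZeroFrom-Updated 100 {X = R} z100)) (seq (pred-correct 65 _) (seq (const-correct 66 2 _)
       (seq (cons-correct 67 66 65 (ZeroFrom-Updated 100 {X = R} z100)) (seq (pred-correct 67 _) (seq (add-correct 67 67 67 (ZeroFrom-Updated 100 {X = R} z100)) (seq inc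
       (seq (zero-correct 64 _) (cons-correct 63 67 64 (ZeroFrom-Updated 100 {X = R} z100))))))))))))))
      where
      z100 : ZeroFrom 100 R
      z100 = ZeroFrom-mono (<ᵇ-lit _) z40

  seq-Σ : ∀ {s s' X Y} {F : ℕ → Regs} → Σ ℕ (λ t → Exec s X (F t)) → (∀ t → Exec s' (F t) Y) → Exec (s ︔ s') X Y
  seq-Σ (t , e) k = seq e (k t)

  SMN-BODY : Stmt → Stmt
  SMN-BODY s = EMIT-LOADER-END s ︔ EMIT-LOADER ︔ EMIT (prefix s) ︔ ZEROS (60 ∷ 61 ∷ 62 ∷ 64 ∷ 65 ∷ 66 ∷ 67 ∷ [])

  smn-body-correct : ∀ s R cv → ZeroFrom 40 R → Exec (SMN-BODY s) (R [ 62 ≔ cv ]) (R [ 63 ≔ smn s cv ])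
  smn-body-correct s R cv z40 =
    seq (emit-loader-end-correct s R cv z40) (seq-Σ (emit-loader-correct cv 0 (loader-start s) (after-loader-end s R cv) refl refl refl q63 (ZeroFrom-Updated 100 {X = R} z100)) λ t1 →
      seq-Σ (emit-correct (prefix s) (loader (loader-start s) (cv + 0)) _ refl (ZeroFrom-Updated 100 {X = R} z100)) λ t2 →
        Exec-resp-≗ (zeros-correct _ _)
         (Updated-≗ R (60 ∷ 61 ∷ 62 ∷ 63 ∷ 64 ∷ 65 ∷ 66 ∷ 67 ∷ [])
           (sym (zz 60) ∷ sym (zz 61) ∷ sym (zz 62) ∷ trans (cong (λ n → ⌜ map ⌜_⌝ᵢ (prefix s ++ loader (loader-start s) n) ⌝) (+-identityʳ cv)) (sym (smn-def s cv)) ∷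
            sym (zz 64) ∷ sym (zz 65) ∷ sym (zz 66) ∷ sym (zz 67) ∷ [])))
    where
    z100 : ZeroFrom 100 R
    z100 = ZeroFrom-mono (<ᵇ-lit _) z40
    zz : ∀ k → {T (39 <ᵇ k)} → R k ≡ 0
    zz k {t} = z40 k (<ᵇ-lit t)
    q63 : cons (suc (w s R cv + w s R cv)) 0 ≡ ⌜ map ⌜_⌝ᵢ (loader (loader-start s + cv) 0) ⌝
    q63 = trans (cong (λ v → cons (suc v) 0) (trans (m+m≡2m (w s R cv)) (cong (2 *_) qw))) (sym (code-∷ ⌜ dec 2 (j s R cv) 1 ⌝ᵢ []))
      where
      qw : w s R cv ≡ π 2 (π (j s R cv) 1)
      qw = trans (cong (λ v → pred (cons 2 v)) (cong pred (sym (suc-π (j s R cv) 1)))) (cong pred (sym (suc-π 2 (π (j s R cv) 1))))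

module Smn where

  open Registers
  open Structured
  open Frames
  open Calls
  open Operations
  open Parameterisation
  open SmnBody
  open import Data.Nat
  open import Data.Nat.Properties
  open import Data.Bool using (T; true; false; not)
  open import Data.Product using (_,_)
  open import Relation.Binary.PropositionalEquality

  SMN : Stmt → ℕ → ℕ → Stmt
  SMN s d cr = ASSIGN 62 cr ︔ SMN-BODY s ︔ TRANSFER d 63

  smn-program-correct : ∀ {R} s d cr → {T (d <ᵇ 40)} → {T (cr <ᵇ 40)} → ZeroFrom 40 R → Exec (SMN s d cr) R (R [ d ≔ smn s (R cr) ])
  smn-program-correct {R} s d cr {td} {tc} z40 =
    seq (assign-correct 62 cr {_} {lt40 {cr} tc} {ne62 {cr} tc} (ZeroFrom-mono (<ᵇ-lit _) z40))
      (seq (smn-body-correct s R (R cr) z40) (Exec-resp-≗ (transfer-correct d 63 _ dne) (≗-by₂ d 63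
          (trans (upd-same _ d _) (trans (upd-same R 63 v) (sym (upd-same R d v))))
          (trans (upd-other _ _ {63} (λ (e : 63 ≡ d) → dne (sym e))) (trans (upd-same (R [ 63 ≔ v ]) 63 0)
            (sym (trans (upd-other R v (λ (e : 63 ≡ d) → dne (sym e))) (z40 63 (<ᵇ-lit _))))))
          (λ i n1 n2 → trans (upd-other _ _ n1) (trans (upd-other _ _ n2) (trans (upd-other R _ n2) (sym (upd-other R _ n1))))))))
    where
    v = smn s (R cr)
    dne : d ≢ 63
    dne e = <⇒≱ (<ᵇ-lit td) (subst (40 ≤_) (sym e) (<ᵇ-lit _))
    lt40 : ∀ {k} → T (k <ᵇ 40) → T (k <ᵇ 100)
    lt40 {k} t = <⇒<ᵇ (≤-trans (<ᵇ-lit {k} {40} t) (<ᵇ-lit {39} {100} _))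
    ne62 : ∀ {k} → T (k <ᵇ 40) → T (not (62 ≡ᵇ k))
    ne62 {k} t with 62 ≡ᵇ k in eq
    ... | true = <⇒≱ (<ᵇ-lit t) (subst (40 ≤_) (≡ᵇ⇒≡ 62 k (subst T (sym eq) _)) (<ᵇ-lit {39} {62} _))
    ... | false = _

  ZeroFrom-init : ∀ x → ZeroFrom 40 (init x)
  ZeroFrom-init x zero ()
  ZeroFrom-init x (suc i) _ = refl

  smn-index : ∀ s x → code (compile (SMN s 0 0) 0) ∙ x ↓ smn s x
  smn-index s x = compile (SMN s 0 0) 0 , code-def (compile (SMN s 0 0) 0) , run-compiled {s = SMN s 0 0} (smn-program-correct s 0 0 (ZeroFrom-init x))

module DedicatedToSupporting where

  open Registers
  open Structured
  open Frames
  open Macros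
  open Pairing
  open Operations
  open RegisterLists using (code-∷)
  open Parameterisation
  open Universal
  open Smn
  open import Data.Nat
  open import Data.List using (List; []; _∷_)
  open import Data.Product using (Σ; _×_; _,_; proj₁; proj₂)
  open import Data.Unit using (tt)
  open import Data.Empty using (⊥-elim)
  open import Data.Bool using (T)
  open import Relation.Nullary using (¬_)
  open import Function.Bundles using (_⇔_; mk⇔)
  open import Relation.Binary.PropositionalEquality

  InTr-root : ∀ S → InTr S []
  InTr-root NIL = tt
  InTr-root (node A σ) = tt

  -- On input ⌜ s ⌝ (register 0) with a dedication code z in register 1,
  -- DESCEND-SIGHT pops the entries a of s, replacing z = ⟨1,⟨n,e⟩⟩ by e a;
  -- NODE-ANSWER then outputs z itself if z = ⟨0,c⟩, and ⟨1,n⟩ otherwise.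
  DESCENT-STEP DESCEND-SIGHT NODE-ANSWER SUPPORTER : Stmt
  DESCENT-STEP = INC 0 ︔ UNCONS 4 0 0 ︔ UNCONS 7 8 1 ︔ UNCONS 9 10 8 ︔ UNCONS 11 12 9 ︔ UNCONS 6 13 12 ︔ UNIV 1 6 4
  DESCEND-SIGHT = LOOP 0 DESCENT-STEP
  NODE-ANSWER = UNCONS 7 8 1 ︔ IFZ 7 (ASSIGN 0 1) (UNCONS 9 10 8 ︔ UNCONS 11 12 9 ︔ ZERO 13 ︔ CONS 12 11 13 ︔ INC 13 ︔ CONS 0 13 12)
  SUPPORTER = DESCEND-SIGHT ︔ NODE-ANSWER

  descent-step-correct : ∀ {R a t n e y P} → R 1 ≡ ⌜ 1 ∷ ⌜ n ∷ e ∷ [] ⌝ ∷ [] ⌝ →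
    e ≡ ⌜ P ⌝ₚ → Run P 0 (init a) y → ZeroFrom 40 R →
    Σ Regs λ R' → Exec DESCENT-STEP (R [ 0 ≔ π a ⌜ t ⌝ ]) R' × R' 0 ≡ ⌜ t ⌝ × R' 1 ≡ y × R' 2 ≡ R 2 × ZeroFrom 40 R'
  descent-step-correct {R} {a} {t} {n} {e} {y} h1 eP run z40 =
    _ , seq inc (seq (uncons-cons-correct 4 0 0 a ⌜ t ⌝ scratch (code-∷ a t))
          (seq (uncons-cons-correct 7 8 1 1 ⌜ x ∷ [] ⌝ scratch (trans h1 (code-∷ 1 (x ∷ []))))
          (seq (uncons-cons-correct 9 10 8 x 0 scratch (code-∷ x []))
          (seq (uncons-cons-correct 11 12 9 n ⌜ e ∷ [] ⌝ scratch (code-∷ n (e ∷ [])))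
          (seq (uncons-cons-correct 6 13 12 e 0 scratch (code-∷ e []))
               (univ-correct 1 6 4 (ZeroFrom-mono (<ᵇ-lit _) (ZeroFrom-Updated 40 {X = R} z40)) eP run))))))
      , refl , refl , refl , ZeroFrom-Updated 40 {X = R} z40
    where
    x = ⌜ n ∷ e ∷ [] ⌝
    scratch : ∀ {A} {{c : Updated R A}} → {T (all<ᵇ 100 (updated-keys c))} → ZeroFrom 100 A
    scratch {{c}} {t} = ZeroFrom-Updated 100 {{c}} {t} (ZeroFrom-mono (<ᵇ-lit _) z40)

  module _ (B : Pred) (θ : ℕ → Pred → Set) (ext : ∀ n → B n → ∀ X Y → (∀ a → X a ⇔ Y a) → θ n X → θ n Y) (p : Pred) where

    Answers : Sight → List ℕ → ℕ → Set
    Answers S s y = (GoodLeaf S s → Zero∧ p y) × (¬ GoodLeaf S s → Σ ℕ λ n → (y ≡ ⌜ 1 ∷ n ∷ [] ⌝) × B n × θ n (Out S s))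

    Answers⇒Supporting : ∀ w S → (∀ s → InTr S s → Σ ℕ λ y → (w ∙ ⌜ s ⌝ ↓ y) × Answers S s y) → Supporting B θ p w S
    Answers⇒Supporting w S answer = good-leaf , other-node
      where
      good-leaf : ∀ s → InTr S s → GoodLeaf S s → w ∙ ⌜ s ⌝ ∈ Zero∧ p
      good-leaf s tr g with answer s tr
      ... | y , run , leaf , _ = y , run , leaf g
      other-node : ∀ s → InTr S s → ¬ GoodLeaf S s → Σ ℕ λ n → (w ∙ ⌜ s ⌝ ↓ ⌜ 1 ∷ n ∷ [] ⌝) × B n × θ n (Out S s)
      other-node s tr ng with answer s tr
      ... | y , run , _ , inner with inner ng
      ... | n , refl , bn , th = n , run , bn , th

    Answers-∷ : ∀ {A σ a t y} → A a → Answers (σ a) t y → Answers (node A σ) (a ∷ t) y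
    Answers-∷ {A} {σ} {a} {t} Aa (leaf , inner) =
      (λ g → leaf (proj₂ g)) ,
      (λ ng → let (n , eq , bn , th) = inner (λ g → ng (Aa , g))
              in n , eq , bn , ext n bn (Out (σ a) t) (Out (node A σ) (a ∷ t)) (λ b → mk⇔ (λ o → Aa , o) proj₂) th)

    z100 : ∀ {R} → ZeroFrom 40 R → ZeroFrom 100 R
    z100 = ZeroFrom-mono (<ᵇ-lit _)

    node-answer-correct : ∀ S z R → Dedicated B θ p z S → R 1 ≡ z → ZeroFrom 40 R → Σ Regs λ R' → Exec NODE-ANSWER R R' × R' 2 ≡ R 2 × Answers S [] (R' 0)
    node-answer-correct NIL z R (c , pc , ze) h1 z40 =
      _ , seq (uncons-cons-correct 7 8 1 0 ⌜ c ∷ [] ⌝ (z100 z40) (trans h1 (trans ze (code-∷ 0 (c ∷ []))))) (ifz0 refl (assign-correct 0 1 (ZeroFrom-Updated 100 {X = R} (z100 z40)))) ,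
      refl , (λ _ → subst (Zero∧ p) (sym h1) (c , pc , ze)) , (λ ng → ⊥-elim (ng tt))
    node-answer-correct (node A σ) z R (n , e , ze , bn , θA , f) h1 z40 =
      _ , seq (uncons-cons-correct 7 8 1 1 ⌜ x ∷ [] ⌝ (z100 z40) (trans h1 (trans ze (code-∷ 1 (x ∷ [])))))
            (ifzS refl (seq (uncons-cons-correct 9 10 8 x 0 (ZeroFrom-Updated 100 {X = R} (z100 z40)) (code-∷ x []))
              (seq (uncons-cons-correct 11 12 9 n ⌜ e ∷ [] ⌝ (ZeroFrom-Updated 100 {X = R} (z100 z40)) (code-∷ n (e ∷ [])))
                (seq (zero-correct 13 _) (seq (cons-correct 12 11 13 (ZeroFrom-Updated 100 {X = R} (z100 z40))) (seq inc (cons-correct 0 13 12 (ZeroFrom-Updated 100 {X = R} (z100 z40))))))))) ,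
      refl , (λ g → ⊥-elim g) ,
      (λ _ → n , sym (trans (code-∷ 1 (n ∷ [])) (cong (cons 1) (code-∷ n []))) , bn ,
         ext n bn A (Out (node A σ) []) (λ a → mk⇔ (λ Aa → Aa , InTr-root (σ a)) proj₁) θA)
      where
      x = ⌜ n ∷ e ∷ [] ⌝

    DescentResult : Sight → List ℕ → Regs → Set
    DescentResult S s R = Σ Regs λ R1 → Exec DESCEND-SIGHT R R1 × R1 2 ≡ R 2 × ZeroFrom 40 R1 × Σ Regs λ R' → Exec NODE-ANSWER R1 R' × R' 2 ≡ R 2 × Answers S s (R' 0)

    descend-through : ∀ {R Rb m S s S' s'} → R 0 ≡ suc m → Exec DESCENT-STEP (R [ 0 ≔ m ]) Rb → Rb 2 ≡ R 2 →
      (∀ {y} → Answers S' s' y → Answers S s y) → DescentResult S' s' Rb → DescentResult S s R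
    descend-through h0 step b2 lift (R1 , e1 , r2 , z1 , R' , e' , r2' , answers) =
      R1 , loopS h0 step e1 , trans r2 b2 , z1 , R' , e' , trans r2' b2 , lift answers

    descend-sight-correct : ∀ s S z R → Dedicated B θ p z S → InTr S s → R 0 ≡ ⌜ s ⌝ → R 1 ≡ z → ZeroFrom 40 R → DescentResult S s R
    descend-sight-correct [] S z R ded tr h0 h1 z40 with node-answer-correct S z R ded h1 z40
    ... | R' , answer , r2 , answers = R , Exec-resp-≗ (loop0 h0) ≗-refl , refl , z40 , R' , answer , r2 , answers
    descend-sight-correct (a ∷ t) NIL z R ded () h0 h1 z40
    descend-sight-correct (a ∷ t) (node A σ) z R (n , e , ze , bn , θA , f) (Aa , tr) h0 h1 z40 =
      let (y , (P , eP , run) , dy) = f a Aa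
          (Rb , step , b0 , b1 , b2 , bz) = descent-step-correct {R} {a} {t} {n} (trans h1 ze) eP run z40
      in descend-through {S = node A σ} {s = a ∷ t} {S' = σ a} {s' = t} h0 step b2 (Answers-∷ {A} {σ} Aa) (descend-sight-correct t (σ a) y Rb dy tr b0 b1 bz)

    supporter-answers : ∀ S z → Dedicated B θ p z S → ∀ s → InTr S s → Σ ℕ λ y → (smn SUPPORTER z ∙ ⌜ s ⌝ ↓ y) × Answers S s y
    supporter-answers S z ded s tr
      with descend-sight-correct s S z (init ⌜ s ⌝ [ 1 ≔ z ]) ded tr refl refl (ZeroFrom-Updated 40 {X = init ⌜ s ⌝} (ZeroFrom-init _))
    ... | _ , descent , _ , _ , R' , answer , r2 , answers = R' 0 , smn-correct SUPPORTER z ⌜ s ⌝ R' (seq descent answer) r2 , answers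

  dedicated⇒supporting : ∀ (B : Pred) θ ext p S z → Dedicated B θ p z S →
    Σ ℕ λ y → (code (compile (SMN SUPPORTER 0 0) 0) ∙ z ↓ y) × Supporting B θ p y S
  dedicated⇒supporting B θ ext p S z ded =
    smn SUPPORTER z , smn-index SUPPORTER z , Answers⇒Supporting B θ ext p (smn SUPPORTER z) S (supporter-answers B θ ext p S z ded)

module SupportingToDedicated where

  open Structured
  open Frames
  open Macros
  open Pairing
  open Operations
  open RegisterLists using (code-∷)
  open Parameterisation
  open Universal
  open CodeEmission
  open Smn
  open DedicatedToSupporting using (InTr-root)
  open import Data.Nat
  open import Data.List using ([]; _∷_)
  open import Data.Product using (Σ; _×_; _,_; proj₁; proj₂)
  open import Data.Unit using (tt)
  open import Data.Bool using (T)
  open import Relation.Nullary using (¬_)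
  open import Function.Bundles using (_⇔_; mk⇔)
  open import Relation.Binary.PropositionalEquality

  -- SHIFT with parameter ⟨w,a⟩ maps ⌜ t ⌝ to w ⌜ a ∷ t ⌝. CHILD with parameter
  -- ⟨h,w⟩ maps a to the run of program h on ⟨h, shift(w,a)⟩. DEDICATOR, on input
  -- ⟨h,w⟩, returns w ⌜ [] ⌝ if it is ⟨0,c⟩ and ⟨1,⟨n,child(h,w)⟩⟩ if it is ⟨1,n⟩.
  -- G-PROGRAM feeds DEDICATOR its own code, so children recurse into DEDICATOR.
  SHIFT CHILD DEDICATOR G-PROGRAM : Stmt
  SHIFT = UNCONS 3 4 1 ︔ CONS 5 4 0 ︔ UNIV 0 3 5
  CHILD = UNCONS 3 4 1 ︔ CONS 5 4 0 ︔ SMN SHIFT 6 5 ︔ CONS 7 3 6 ︔ UNIV 0 3 7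
  DEDICATOR = UNCONS 3 4 0 ︔ ZERO 5 ︔ UNIV 6 4 5 ︔ UNCONS 7 8 6 ︔ IFZ 7 (ASSIGN 0 6)
    (UNCONS 9 10 8 ︔ CONS 11 3 4 ︔ SMN CHILD 12 11 ︔ ZERO 13 ︔ CONS 14 12 13 ︔ CONS 15 9 14 ︔ CONS 16 15 13 ︔ INC 13 ︔ CONS 0 13 16)

  dedicator-code : ℕ
  dedicator-code = code (compile DEDICATOR 0)

  G-PROGRAM = CONST 3 dedicator-code ︔ CONS 0 3 0 ︔ DEDICATOR

  private
    ZeroFrom-40⇒100 : ∀ {R} → ZeroFrom 40 R → ZeroFrom 100 R
    ZeroFrom-40⇒100 = ZeroFrom-mono (<ᵇ-lit _)

    ZeroFrom-40⇒80 : ∀ {R} → ZeroFrom 40 R → ZeroFrom 80 R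
    ZeroFrom-40⇒80 = ZeroFrom-mono (<ᵇ-lit _)

  shift-correct : ∀ w a t y → w ∙ ⌜ a ∷ t ⌝ ↓ y → smn SHIFT (cons w a) ∙ ⌜ t ⌝ ↓ y
  shift-correct w a t y (P , eP , run) = smn-correct SHIFT (cons w a) ⌜ t ⌝ _
    (seq (uncons-cons-correct 3 4 1 w a (ZeroFrom-40⇒100 z) refl)
    (seq (cons-correct 5 4 0 (ZeroFrom-Updated 100 {X = init ⌜ t ⌝} (ZeroFrom-40⇒100 (ZeroFrom-init _))))
         (univ-correct {P = P} 0 3 5 (ZeroFrom-40⇒80 (ZeroFrom-Updated 40 {X = init ⌜ t ⌝} (ZeroFrom-init _))) eP
            (subst (λ v → Run P 0 (init v) y) (code-∷ a t) run)))) refl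
    where
    z : ZeroFrom 40 (init ⌜ t ⌝ [ 1 ≔ cons w a ])
    z = ZeroFrom-Updated 40 {X = init ⌜ t ⌝} (ZeroFrom-init _)

  child-correct : ∀ h w a {P y} → h ≡ ⌜ P ⌝ₚ → Run P 0 (init (cons h (smn SHIFT (cons w a)))) y →
    smn CHILD (cons h w) ∙ a ↓ y
  child-correct h w a {P} hP run = smn-correct CHILD (cons h w) a _
    (seq (uncons-cons-correct 3 4 1 h w (ZeroFrom-40⇒100 z) refl)
    (seq (cons-correct 5 4 0 (ZeroFrom-Updated 100 {X = init a} (ZeroFrom-40⇒100 (ZeroFrom-init _))))
    (seq (smn-program-correct SHIFT 6 5 (ZeroFrom-Updated 40 {X = init a} (ZeroFrom-init _)))
    (seq (cons-correct 7 3 6 (ZeroFrom-Updated 100 {X = init a} (ZeroFrom-40⇒100 (ZeroFrom-init _))))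
         (univ-correct {P = P} 0 3 7 (ZeroFrom-40⇒80 (ZeroFrom-Updated 40 {X = init a} (ZeroFrom-init _))) hP run))))) refl
    where
    z : ZeroFrom 40 (init a [ 1 ≔ cons h w ])
    z = ZeroFrom-Updated 40 {X = init a} (ZeroFrom-init _)

  dedicator-leaf : ∀ {R h w y c} → R 0 ≡ cons h w → w ∙ ⌜ [] ⌝ ↓ y → y ≡ ⌜ 0 ∷ c ∷ [] ⌝ → ZeroFrom 40 R →
    Σ Regs λ R' → Exec DEDICATOR R R' × R' 0 ≡ y
  dedicator-leaf {R} {h} {w} {y} {c} h0 (P , eP , run) y≡ z40 =
    _ , seq (uncons-cons-correct 3 4 0 h w (ZeroFrom-40⇒100 z40) h0)
        (seq (zero-correct 5 _)
        (seq (univ-correct {P = P} 6 4 5 (ZeroFrom-40⇒80 (ZeroFrom-Updated 40 {X = R} z40)) eP run)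
        (seq (uncons-cons-correct 7 8 6 0 ⌜ c ∷ [] ⌝ scratch (trans y≡ (code-∷ 0 (c ∷ []))))
             (ifz0 refl (assign-correct 0 6 scratch)))))
      , refl
    where
    scratch : ∀ {A} {{u : Updated R A}} → {T (all<ᵇ 100 (updated-keys u))} → ZeroFrom 100 A
    scratch {{u}} {t} = ZeroFrom-Updated 100 {{u}} {t} (ZeroFrom-40⇒100 z40)

  dedicator-node : ∀ {R h w n} → R 0 ≡ cons h w → w ∙ ⌜ [] ⌝ ↓ ⌜ 1 ∷ n ∷ [] ⌝ → ZeroFrom 40 R →
    Σ Regs λ R' → Exec DEDICATOR R R' × R' 0 ≡ ⌜ 1 ∷ ⌜ n ∷ smn CHILD (cons h w) ∷ [] ⌝ ∷ [] ⌝
  dedicator-node {R} {h} {w} {n} h0 (P , eP , run) z40 =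
    _ , seq (uncons-cons-correct 3 4 0 h w (ZeroFrom-40⇒100 z40) h0)
        (seq (zero-correct 5 _)
        (seq (univ-correct {P = P} 6 4 5 (ZeroFrom-40⇒80 (ZeroFrom-Updated 40 {X = R} z40)) eP run)
        (seq (uncons-cons-correct 7 8 6 1 ⌜ n ∷ [] ⌝ scratch (code-∷ 1 (n ∷ [])))
        (ifzS refl
        (seq (uncons-cons-correct 9 10 8 n 0 scratch (code-∷ n []))
        (seq (cons-correct 11 3 4 scratch)
        (seq (smn-program-correct CHILD 12 11 (ZeroFrom-Updated 40 {X = R} z40))
        (seq (zero-correct 13 _)
        (seq (cons-correct 14 12 13 scratch)
        (seq (cons-correct 15 9 14 scratch)
        (seq (cons-correct 16 15 13 scratch)
        (seq inc (cons-correct 0 13 16 scratch)))))))))))))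
      , sym (trans (code-∷ 1 (x ∷ [])) (cong (cons 1) (trans (code-∷ x [])
          (cong (λ v → cons v 0) (trans (code-∷ n (e ∷ [])) (cong (cons n) (code-∷ e [])))))))
    where
    e = smn CHILD (cons h w)
    x = ⌜ n ∷ e ∷ [] ⌝
    scratch : ∀ {A} {{u : Updated R A}} → {T (all<ᵇ 100 (updated-keys u))} → ZeroFrom 100 A
    scratch {{u}} {t} = ZeroFrom-Updated 100 {{u}} {t} (ZeroFrom-40⇒100 z40)

  G-PROGRAM-correct : ∀ w {R'} → Exec DEDICATOR (init w [ 3 ≔ dedicator-code ] [ 0 ≔ cons dedicator-code w ]) R' →
    code (compile G-PROGRAM 0) ∙ w ↓ R' 0
  G-PROGRAM-correct w ex = compile G-PROGRAM 0 , code-def (compile G-PROGRAM 0) , run-compiled {s = G-PROGRAM}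
    (seq (const-correct 3 dedicator-code _) (seq (cons-correct 0 3 0 (ZeroFrom-40⇒100 (ZeroFrom-Updated 40 {X = init w} (ZeroFrom-init w)))) ex))

  module _ (B : Pred) (θ : ℕ → Pred → Set) (ext : ∀ n → B n → ∀ X Y → (∀ a → X a ⇔ Y a) → θ n X → θ n Y) (p : Pred) where

    Supporting-child : ∀ {A σ w a} → A a → Supporting B θ p w (node A σ) → Supporting B θ p (smn SHIFT (cons w a)) (σ a)
    Supporting-child {A} {σ} {w} {a} Aa (good , inner) = good-leaf , other-node
      where
      w' = smn SHIFT (cons w a)
      good-leaf : ∀ t → InTr (σ a) t → GoodLeaf (σ a) t → w' ∙ ⌜ t ⌝ ∈ Zero∧ p
      good-leaf t tr g with good (a ∷ t) (Aa , tr) (Aa , g)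
      ... | y , run , leaf = y , shift-correct w a t y run , leaf
      other-node : ∀ t → InTr (σ a) t → ¬ GoodLeaf (σ a) t → Σ ℕ λ n → (w' ∙ ⌜ t ⌝ ↓ ⌜ 1 ∷ n ∷ [] ⌝) × B n × θ n (Out (σ a) t)
      other-node t tr ng with inner (a ∷ t) (Aa , tr) (λ g → ng (proj₂ g))
      ... | n , run , bn , θn =
        n , shift-correct w a t ⌜ 1 ∷ n ∷ [] ⌝ run , bn , ext n bn (Out (node A σ) (a ∷ t)) (Out (σ a) t) (λ b → mk⇔ proj₂ (λ o → Aa , o)) θn

    dedicator-correct : ∀ S w → Supporting B θ p w S → ∀ R → R 0 ≡ cons dedicator-code w → ZeroFrom 40 R →
      Σ Regs λ R' → Exec DEDICATOR R R' × Dedicated B θ p (R' 0) S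
    dedicator-correct NIL w (good , _) R h0 z40 = from-leaf (good [] tt tt)
      where
      from-leaf : w ∙ ⌜ [] ⌝ ∈ Zero∧ p → Σ Regs λ R' → Exec DEDICATOR R R' × Dedicated B θ p (R' 0) NIL
      from-leaf (y , run , c , pc , y≡) = finish (dedicator-leaf {R} {dedicator-code} {w} {y} {c} h0 run y≡ z40)
        where
        finish : (Σ Regs λ R' → Exec DEDICATOR R R' × R' 0 ≡ y) → Σ Regs λ R' → Exec DEDICATOR R R' × Dedicated B θ p (R' 0) NIL
        finish (R' , ex , out) = R' , ex , c , pc , trans out y≡
    dedicator-correct (node A σ) w sup R h0 z40 = from-node (proj₂ sup [] tt (λ ()))
      where
      e = smn CHILD (cons dedicator-code w)

      child-dedicated : ∀ a → A a → Σ ℕ λ y → (e ∙ a ↓ y) × Dedicated B θ p y (σ a)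
      child-dedicated a Aa = finish (dedicator-correct (σ a) w' (Supporting-child Aa sup) (init (cons dedicator-code w')) refl (ZeroFrom-init _))
        where
        w' = smn SHIFT (cons w a)
        finish : (Σ Regs λ R' → Exec DEDICATOR (init (cons dedicator-code w')) R' × Dedicated B θ p (R' 0) (σ a)) →
          Σ ℕ λ y → (e ∙ a ↓ y) × Dedicated B θ p y (σ a)
        finish (R' , ex , ded) = R' 0 , child-correct dedicator-code w a {P = compile DEDICATOR 0} (code-def (compile DEDICATOR 0)) (run-compiled ex) , ded

      from-node : (Σ ℕ λ n → (w ∙ ⌜ [] ⌝ ↓ ⌜ 1 ∷ n ∷ [] ⌝) × B n × θ n (Out (node A σ) [])) →
        Σ Regs λ R' → Exec DEDICATOR R R' × Dedicated B θ p (R' 0) (node A σ)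
      from-node (n , run , bn , θn) = finish (dedicator-node {R} {dedicator-code} {w} {n} h0 run z40)
        where
        finish : (Σ Regs λ R' → Exec DEDICATOR R R' × R' 0 ≡ ⌜ 1 ∷ ⌜ n ∷ e ∷ [] ⌝ ∷ [] ⌝) →
          Σ Regs λ R' → Exec DEDICATOR R R' × Dedicated B θ p (R' 0) (node A σ)
        finish (R' , ex , out) =
          R' , ex , n , e , out , bn , ext n bn (Out (node A σ) []) A (λ a → mk⇔ proj₁ (λ Aa → Aa , InTr-root (σ a))) θn , child-dedicated

  supporting⇒dedicated : ∀ (B : Pred) θ ext p S w → Supporting B θ p w S →
    Σ ℕ λ y → (code (compile G-PROGRAM 0) ∙ w ↓ y) × Dedicated B θ p y S
  supporting⇒dedicated B θ ext p S w sup = finish (dedicator-correct B θ ext p S w sup R₀ refl (ZeroFrom-Updated 40 {X = init w} (ZeroFrom-init w)))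
    where
    R₀ = init w [ 3 ≔ dedicator-code ] [ 0 ≔ cons dedicator-code w ]
    finish : (Σ Regs λ R' → Exec DEDICATOR R₀ R' × Dedicated B θ p (R' 0) S) →
      Σ ℕ λ y → (code (compile G-PROGRAM 0) ∙ w ↓ y) × Dedicated B θ p y S
    finish (R' , ex , ded) = R' 0 , G-PROGRAM-correct w ex , ded

open Parameterisation using (code)
open Structured using (compile)
open Smn using (SMN)
open DedicatedToSupporting using (dedicated⇒supporting; SUPPORTER)
open SupportingToDedicated using (supporting⇒dedicated; G-PROGRAM)

proposition4p9 : Σ ℕ λ F → Σ ℕ λ G →
    (B : Pred) → Σ ℕ B →
    (θ : ℕ → Pred → Set) →
    (∀ n → B n → ∀ X Y → (∀ a → X a ⇔ Y a) → θ n X → θ n Y) →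
    (p : Pred) → (S : Sight) → (z w : ℕ) →
    (Dedicated B θ p z S → Σ ℕ λ y → (F ∙ z ↓ y) × Supporting B θ p y S) ×
    (Supporting B θ p w S → Σ ℕ λ y → (G ∙ w ↓ y) × Dedicated B θ p y S)
proposition4p9 = code (compile (SMN SUPPORTER 0 0) 0) , code (compile G-PROGRAM 0) ,
  λ B _ θ ext p S z w → dedicated⇒supporting B θ ext p S z , supporting⇒dedicated B θ ext p S w
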